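{- If $\mathbf{a}=(a_1,\dots,a_n)$ is a weak composition that is not pure, then $\mathcal{P}(\mathbb{D}(\mathbf{a}))$ is not ranked.
   Context: A diagram is a finite set $D$ of cells $(r,c)$ with $r,c$ positive integers; $r$ is the row (rows numbered from bottom to top starting at 1) and $c$ the column (numbered from left to right starting at 1). A Kohnert move at row $r$ applied to a diagram $D$: if row $r$ of $D$ is empty, $D$ is unchanged; otherwise let $(r,c)$ be the cell of row $r$ with the largest column index; if every position $(r',c)$ with $1\le r'<r$ belongs to $D$, then $D$ is unchanged; otherwise let $r'$ be the largest integer with $1\le r'<r$ and $(r',c)\notin D$, and the move replaces the cell $(r,c)$ by $(r',c)$. For a diagram $D_0$, $KD(D_0)$ is the set of all diagrams obtainable from $D_0$ by finite (possibly empty) sequences of Kohnert moves; the Kohnert poset $\mathcal{P}(D_0)$ is $KD(D_0)$ ordered by $D_2\preceq D_1$ iff $D_2$ can be obtained from $D_1$ by a finite sequence of Kohnert moves. A finite poset $P$ is ranked if there is a function $\rho:P\to\mathbb{Z}_{\ge0}$ such that $x\prec y$ implies $\rho(x)<\rho(y)$ and $\rho(y)=\rho(x)+1$ whenever $y$ covers $x$. For a weak composition $\mathbf{a}=(a_1,\dots,a_n)\in\mathbb{Z}_{\ge0}^n$, the key diagram is $\mathbb{D}(\mathbf{a})=\bigcup_{i=1}^n\{(i,j):1\le j\le a_i\}$. The weak composition $\mathbf{a}$ is pure if there are no indices $1\le j_1<j_2<j_3\le n$ with $a_{j_1}<a_{j_2}<a_{j_3}$, or $a_{j_1}<a_{j_3}<a_{j_2}$,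 or $a_{j_1}+1<a_{j_2}=a_{j_3}$. -}

module Defs where

open import Data.Nat using (ℕ; zero; suc; _≤_; _<_; _+_)
open import Data.Product using (_×_; _,_; Σ; ∃; ∃-syntax)
open import Data.Sum using (_⊎_)
open import Data.List using (List; []; _∷_; _++_; map; upTo)
open import Data.List.Membership.Propositional using (_∈_; _∉_)
open import Data.Vec using (Vec; lookup; toList)
open import Data.Fin using (Fin)
import Data.Fin as F
open import Relation.Nullary using (¬_)
open import Relation.Binary.PropositionalEquality using (_≡_; _≢_)

-- A cell (r , c): r = row (bottom to top, from 1), c = column (from 1).
Cell : Set
Cell = ℕ × ℕ

-- A diagram is a finite set of cells, represented by a list;
-- lists are compared as sets (same members).
Diagram : Set
Diagram = List Cell

_≈_ : Diagram → Diagram → Set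
D ≈ E = ∀ p → (p ∈ D → p ∈ E) × (p ∈ E → p ∈ D)

-- A (non-trivial) Kohnert move at row r takes D to E.
-- c is the largest column index of a cell in row r; r' is the largest
-- row index with 1 ≤ r' < r and (r' , c) ∉ D; E = D ∖ {(r,c)} ∪ {(r',c)}.
-- (Moves that leave D unchanged are irrelevant for reachability, since
-- reachability already includes the empty sequence.)
KohnertMove : ℕ → Diagram → Diagram → Set
KohnertMove r D E =
  ∃[ c ] ∃[ r' ]
    ( (r , c) ∈ D
    × (∀ c' → (r , c') ∈ D → c' ≤ c)
    × 1 ≤ r' × r' < r
    × (r' , c) ∉ D
    × (∀ s → r' < s → s < r → (s , c) ∈ D)
    × (∀ p → (p ∈ E → (p ≡ (r' , c) ⊎ (p ∈ D × p ≢ (r , c))))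
           × ((p ≡ (r' , c) ⊎ (p ∈ D × p ≢ (r , c))) → p ∈ E)) )

data _⇝*_ : Diagram → Diagram → Set where
  done : ∀ {D E} → D ≈ E → D ⇝* E
  step : ∀ {D E F} r → KohnertMove r D E → E ⇝* F → D ⇝* F

KD : Diagram → Set
KD D0 = Σ Diagram (λ D → D0 ⇝* D)

module KohnertPoset (D0 : Diagram) where
  _≈P_ : KD D0 → KD D0 → Set
  (x , _) ≈P (y , _) = x ≈ y

  _⪯_ : KD D0 → KD D0 → Set
  (x , _) ⪯ (y , _) = y ⇝* x

  _≺_ : KD D0 → KD D0 → Set
  x ≺ y = (x ⪯ y) × ¬ (x ≈P y)

  Covers : KD D0 → KD D0 → Set
  Covers y x = (x ≺ y) × (∀ z → ¬ ((x ≺ z) × (z ≺ y)))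

Ranked : (P : Set) (_≈'_ _≺'_ : P → P → Set) → Set
Ranked P _≈'_ _≺'_ =
  Σ (P → ℕ) λ ρ →
    (∀ x y → x ≈' y → ρ x ≡ ρ y)
  × (∀ x y → x ≺' y → ρ x < ρ y)
  × (∀ x y → (x ≺' y) × (∀ z → ¬ ((x ≺' z) × (z ≺' y))) → ρ y ≡ suc (ρ x))

KohnertRanked : Diagram → Set
KohnertRanked D0 = Ranked (KD D0) _≈P_ _≺_
  where open KohnertPoset D0

keyFrom : ℕ → List ℕ → Diagram
keyFrom r [] = []
keyFrom r (x ∷ xs) = map (λ j → (r , suc j)) (upTo x) ++ keyFrom (suc r) xs

keyDiagram : ∀ {n} → Vec ℕ n → Diagram
keyDiagram a = keyFrom 1 (toList a)

Pure : ∀ {n} → Vec ℕ n → Set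
Pure {n} a = ∀ (j₁ j₂ j₃ : Fin n) → j₁ F.< j₂ → j₂ F.< j₃ →
  ¬ ( (lookup a j₁ < lookup a j₂ × lookup a j₂ < lookup a j₃)
    ⊎ (lookup a j₁ < lookup a j₃ × lookup a j₃ < lookup a j₂)
    ⊎ (suc (lookup a j₁) < lookup a j₂ × lookup a j₂ ≡ lookup a j₃) )

module Submission where

-- Call a Kohnert move of (r , c) down to (t , c) a cover move when
-- every row strictly between t and r extends past column c. A cover move is a
-- covering relation of the Kohnert poset: moves only lower the column counts
-- "cells of column d in rows ≥ t₀", which determine a diagram, and the first
-- move of any descent to the target must lower counts the cover move lowers,
-- which pins it down. Hence a rank function drops by exactly one along every
-- cover move, and two sequences of cover moves from a reachable diagram to the
-- same diagram have the same length.
-- A violation of purity by rows j₁ < j₂ < j₃ of the key diagram is first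
-- brought, by cover moves, to three adjacent rows p, p + 1, p + 2 whose
-- parts beyond column x = a_{j₁} are empty, of length V and of length z
-- (V < z, z < V, or V = z ≥ 2). For each of these three shapes two explicit
-- sequences of cover moves reach the same diagram with different lengths.

open import Data.Empty using (⊥; ⊥-elim)
open import Data.Fin using (Fin; toℕ) renaming (zero to fzero; suc to fsuc)
import Data.Fin as Fin
open import Data.Fin.Properties using (¬∀⟶∃¬; all?)
open import Data.List using (List; []; _∷_; map; filter; upTo; length)
open import Data.List.Membership.Propositional using (_∈_; _∉_)
open import Data.List.Membership.Propositional.Properties
  using (∈-filter⁺; ∈-filter⁻; ∈-map⁺; ∈-map⁻; ∈-++⁺ˡ; ∈-++⁺ʳ; ∈-++⁻; ∈-upTo⁺; ∈-upTo⁻)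
open import Data.List.Relation.Unary.Any using (here; there)
open import Data.Nat using (ℕ; zero; suc; _+_; _∸_; _≤_; _<_; z≤n; s≤s; _≟_; _≤?_; _<?_)
open import Data.Nat.Properties
open import Algebra.Properties.CommutativeSemigroup +-commutativeSemigroup using (interchange)
open import Data.Product using (_×_; _,_; ∃-syntax; proj₁; proj₂)
open import Data.Product.Properties using (≡-dec)
open import Data.Sum using (_⊎_; inj₁; inj₂)
open import Data.Vec using (Vec; lookup; toList) renaming (_∷_ to _∷ᵥ_)
open import Function using (_∘_; case_of_)
open import Function.Bundles using (_⇔_; mk⇔; Equivalence)
open import Function.Construct.Composition using (_⇔-∘_)
open import Function.Construct.Identity using (⇔-id)
open import Function.Construct.Symmetry using (⇔-sym)
open import Relation.Binary.Definitions using (DecidableEquality; tri<; tri≈; tri>)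
open import Relation.Binary.PropositionalEquality
open import Relation.Nullary using (¬_; Dec; yes; no; ¬?)
open import Relation.Nullary.Decidable using (_⊎-dec_; _×-dec_; _→-dec_)

open import Defs

open Equivalence using (to; from)

_≟ᶜ_ : DecidableEquality Cell
_≟ᶜ_ = ≡-dec _≟_ _≟_

open import Data.List.Membership.DecPropositional _≟ᶜ_ using (_∈?_)

Moved : ℕ → ℕ → ℕ → Diagram → Diagram → Set
Moved r c t D E = ∀ p → (p ∈ E → (p ≡ (t , c) ⊎ (p ∈ D × p ≢ (r , c))))
                      × ((p ≡ (t , c) ⊎ (p ∈ D × p ≢ (r , c))) → p ∈ E)

move : ℕ → ℕ → ℕ → Diagram → Diagram
move r c t D = (t , c) ∷ filter (λ p → ¬? (p ≟ᶜ (r , c))) D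

∈-move⁻ : ∀ {r c t D} p → p ∈ move r c t D → p ≡ (t , c) ⊎ (p ∈ D × p ≢ (r , c))
∈-move⁻ p (here e) = inj₁ e
∈-move⁻ {r} {c} p (there m) = inj₂ (∈-filter⁻ (λ q → ¬? (q ≟ᶜ (r , c))) m)

∈-move⁺ : ∀ {r c t D} p → p ≡ (t , c) ⊎ (p ∈ D × p ≢ (r , c)) → p ∈ move r c t D
∈-move⁺ p (inj₁ e) = here e
∈-move⁺ {r} {c} p (inj₂ (m , ne)) = there (∈-filter⁺ (λ q → ¬? (q ≟ᶜ (r , c))) m ne)

move-Moved : ∀ {r c t D} → Moved r c t D (move r c t D)
move-Moved p = ∈-move⁻ p , ∈-move⁺ p

moved-∉ : ∀ {r c t D E} → t < r → Moved r c t D E → (r , c) ∉ E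
moved-∉ t<r moved m with proj₁ (moved _) m
... | inj₁ e = <-irrefl (sym (cong proj₁ e)) t<r
... | inj₂ (_ , ne) = ne refl

≈-refl : ∀ {D} → D ≈ D
≈-refl p = (λ m → m) , (λ m → m)

≈-sym : ∀ {D E} → D ≈ E → E ≈ D
≈-sym e p = proj₂ (e p) , proj₁ (e p)

record CoverMove (r c t : ℕ) (D : Diagram) : Set where
  constructor coverMove
  field
    cell       : (r , c) ∈ D
    rightmost  : ∀ c' → (r , c') ∈ D → c' ≤ c
    target≥1   : 1 ≤ t
    target<r   : t < r
    targetFree : (t , c) ∉ D
    gapFilled  : ∀ s → t < s → s < r → (s , c) ∈ D
    gapExtends : ∀ s → t < s → s < r → ∃[ c' ] (c < c' × (s , c') ∈ D)

coverMove⇒KohnertMove : ∀ {r c t D} → CoverMove r c t D → KohnertMove r D (move r c t D)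
coverMove⇒KohnertMove {c = c} {t} (coverMove i tp t1 tr tf fl _) =
  c , t , i , tp , t1 , tr , tf , fl , move-Moved

adjacentMove : ∀ {t c D} → (suc t , c) ∈ D → (∀ c' → (suc t , c') ∈ D → c' ≤ c) →
  1 ≤ t → (t , c) ∉ D → CoverMove (suc t) c t D
adjacentMove i tp t1 tf =
  coverMove i tp t1 ≤-refl tf (λ _ a b → ⊥-elim (<⇒≱ a (≤-pred b))) (λ _ a b → ⊥-elim (<⇒≱ a (≤-pred b)))

jumpMove : ∀ {t c c' D} → (suc (suc t) , c) ∈ D → (∀ c'' → (suc (suc t) , c'') ∈ D → c'' ≤ c) →
  1 ≤ t → (t , c) ∉ D → (suc t , c) ∈ D → c < c' → (suc t , c') ∈ D → CoverMove (suc (suc t)) c t D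
jumpMove {t} {c} {c'} {D} i tp t1 tf gap c<c' gap' =
  coverMove i tp t1 (m≤n⇒m≤1+n (n<1+n t)) tf
    (λ s a b → subst (λ s → (s , c) ∈ D) (middle a b) gap)
    (λ s a b → c' , c<c' , subst (λ s → (s , c') ∈ D) (middle a b) gap')
  where
  middle : ∀ {s} → t < s → s < suc (suc t) → suc t ≡ s
  middle a b = ≤-antisym a (≤-pred b)

infixr 5 _◅_ _◅◅_

data Path : ℕ → Diagram → Diagram → Set where
  ε   : ∀ {D} → Path 0 D D
  _◅_ : ∀ {k D E r c t} → CoverMove r c t D → Path k (move r c t D) E → Path (suc k) D E

_◅◅_ : ∀ {k l D E F} → Path k D E → Path l E F → Path (k + l) D F
ε ◅◅ Q = Q
(g ◅ P) ◅◅ Q = g ◅ (P ◅◅ Q)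

Path⇒⇝* : ∀ {k D E} → Path k D E → D ⇝* E
Path⇒⇝* ε = done ≈-refl
Path⇒⇝* (_◅_ {r = r} g P) = step r (coverMove⇒KohnertMove g) (Path⇒⇝* P)

RowBounded : ℕ → Diagram → Set
RowBounded B D = ∀ r c → (r , c) ∈ D → r ≤ B

moved-rowBounded : ∀ {B r c t D E} → (r , c) ∈ D → t < r → Moved r c t D E → RowBounded B D → RowBounded B E
moved-rowBounded i t<r moved bd r₀ c₀ m with proj₁ (moved (r₀ , c₀)) m
... | inj₁ refl = ≤-trans (<⇒≤ t<r) (bd _ _ i)
... | inj₂ (m' , _) = bd r₀ c₀ m'

kohnertMove-rowBounded : ∀ {B r D E} → KohnertMove r D E → RowBounded B D → RowBounded B E
kohnertMove-rowBounded (_ , _ , i , _ , _ , t<r , _ , _ , moved) = moved-rowBounded i t<r moved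

⇝*-rowBounded : ∀ {B D E} → D ⇝* E → RowBounded B D → RowBounded B E
⇝*-rowBounded (done e) bd r₀ c₀ m = bd r₀ c₀ (proj₂ (e (r₀ , c₀)) m)
⇝*-rowBounded (step r km s) bd = ⇝*-rowBounded s (kohnertMove-rowBounded km bd)

-- Column counts

indicator : ∀ {P : Set} → Dec P → ℕ
indicator (yes _) = 1
indicator (no _) = 0

indicator-yes : ∀ {P : Set} (P? : Dec P) → P → indicator P? ≡ 1
indicator-yes (yes _) _ = refl
indicator-yes (no ¬p) p = ⊥-elim (¬p p)

indicator-no : ∀ {P : Set} (P? : Dec P) → ¬ P → indicator P? ≡ 0
indicator-no (yes p) ¬p = ⊥-elim (¬p p)
indicator-no (no _) _ = refl

indicator-1 : ∀ {P : Set} (P? : Dec P) → indicator P? ≡ 1 → P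
indicator-1 (yes p) _ = p

indicator-cong : ∀ {P Q : Set} (P? : Dec P) (Q? : Dec Q) → (P → Q) → (Q → P) → indicator P? ≡ indicator Q?
indicator-cong (yes _) (yes _) _ _ = refl
indicator-cong (no _) (no _) _ _ = refl
indicator-cong (yes p) (no ¬q) f _ = ⊥-elim (¬q (f p))
indicator-cong (no ¬p) (yes q) _ g = ⊥-elim (¬p (g q))

χ : Diagram → Cell → ℕ
χ D p = indicator (p ∈? D)

δ : Cell → Cell → ℕ
δ q p = indicator (p ≟ᶜ q)

sumFrom : (ℕ → ℕ) → ℕ → ℕ → ℕ
sumFrom g t zero = 0
sumFrom g t (suc f) = g t + sumFrom g (suc t) f

sumFrom-cong : ∀ {g h} t f → (∀ k → g k ≡ h k) → sumFrom g t f ≡ sumFrom h t f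
sumFrom-cong t zero e = refl
sumFrom-cong t (suc f) e = cong₂ _+_ (e t) (sumFrom-cong (suc t) f e)

sumFrom-+ : ∀ g h t f → sumFrom (λ k → g k + h k) t f ≡ sumFrom g t f + sumFrom h t f
sumFrom-+ g h t zero = refl
sumFrom-+ g h t (suc f) =
  trans (cong (g t + h t +_) (sumFrom-+ g h (suc t) f)) (interchange (g t) (h t) _ _)

sumFrom-zero : ∀ g t f → (∀ k → t ≤ k → g k ≡ 0) → sumFrom g t f ≡ 0
sumFrom-zero g t zero z = refl
sumFrom-zero g t (suc f) z =
  cong₂ _+_ (z t ≤-refl) (sumFrom-zero g (suc t) f (λ k t<k → z k (<⇒≤ t<k)))

sumFrom-point : ∀ g t f k₀ → t ≤ k₀ → k₀ < t + f → g k₀ ≡ 1 → (∀ k → k ≢ k₀ → g k ≡ 0) →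
  sumFrom g t f ≡ 1
sumFrom-point g t zero k₀ t≤k₀ k₀<t _ _ = ⊥-elim (<⇒≱ k₀<t (≤-trans (≤-reflexive (+-identityʳ t)) t≤k₀))
sumFrom-point g t (suc f) k₀ t≤k₀ k₀<t+f one rest with t ≟ k₀
... | yes refl = cong₂ _+_ one (sumFrom-zero g (suc t) f (λ k t<k → rest k (λ e → <-irrefl (sym e) t<k)))
... | no t≢k₀ = cong₂ _+_ (rest t t≢k₀)
  (sumFrom-point g (suc t) f k₀ (≤∧≢⇒< t≤k₀ t≢k₀) (subst (k₀ <_) (+-suc t f) k₀<t+f) one rest)

colSum : ℕ → (Cell → ℕ) → ℕ → ℕ → ℕ
colSum B ξ d t = sumFrom (λ k → ξ (k , d)) t (suc B ∸ t)

colSum-δ-in : ∀ B k₀ c₀ t → t ≤ k₀ → k₀ ≤ B → colSum B (δ (k₀ , c₀)) c₀ t ≡ 1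
colSum-δ-in B k₀ c₀ t t≤k₀ k₀≤B =
  sumFrom-point _ t (suc B ∸ t) k₀ t≤k₀ (≤-trans (s≤s k₀≤B) (m≤n+m∸n (suc B) t))
    (indicator-yes ((k₀ , c₀) ≟ᶜ (k₀ , c₀)) refl)
    (λ k k≢k₀ → indicator-no ((k , c₀) ≟ᶜ (k₀ , c₀)) (λ e → k≢k₀ (cong proj₁ e)))

colSum-δ-out : ∀ B k₀ c₀ d t → ¬ (d ≡ c₀ × t ≤ k₀) → colSum B (δ (k₀ , c₀)) d t ≡ 0
colSum-δ-out B k₀ c₀ d t out = sumFrom-zero _ t (suc B ∸ t)
  (λ k t≤k → indicator-no ((k , d) ≟ᶜ (k₀ , c₀)) λ { refl → out (refl , t≤k) })

χ-moved : ∀ {r c t D E} → (r , c) ∈ D → (t , c) ∉ D → t < r → Moved r c t D E →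
  ∀ p → χ E p + δ (r , c) p ≡ χ D p + δ (t , c) p
χ-moved {r} {c} {t} {D} {E} i tf t<r moved p with p ≟ᶜ (r , c) | p ≟ᶜ (t , c)
... | yes refl | yes e = ⊥-elim (<-irrefl (sym (cong proj₁ e)) t<r)
... | yes refl | no _
  rewrite indicator-no (p ∈? E) (moved-∉ t<r moved) | indicator-yes (p ∈? D) i = refl
... | no _ | yes refl
  rewrite indicator-yes (p ∈? E) (proj₂ (moved p) (inj₁ refl)) | indicator-no (p ∈? D) tf = refl
... | no p≢r | no p≢t = cong (_+ 0) (indicator-cong (p ∈? E) (p ∈? D) E⊆D D⊆E)
  where
  E⊆D : p ∈ E → p ∈ D
  E⊆D m with proj₁ (moved p) m
  ... | inj₁ e = ⊥-elim (p≢t e)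
  ... | inj₂ (m' , _) = m'
  D⊆E : p ∈ D → p ∈ E
  D⊆E m = proj₂ (moved p) (inj₂ (m , p≢r))

count : ℕ → Diagram → ℕ → ℕ → ℕ
count B D = colSum B (χ D)

count-≈ : ∀ B {D E} → D ≈ E → ∀ d t₀ → count B D d t₀ ≡ count B E d t₀
count-≈ B {D} {E} e d t₀ = sumFrom-cong t₀ (suc B ∸ t₀)
  (λ k → indicator-cong ((k , d) ∈? D) ((k , d) ∈? E) (proj₁ (e (k , d))) (proj₂ (e (k , d))))

count-unfold : ∀ B D d k → k ≤ B → count B D d k ≡ χ D (k , d) + count B D d (suc k)
count-unfold B D d k k≤B rewrite +-∸-assoc 1 k≤B = refl

count-injective : ∀ B {D E} → RowBounded B D → RowBounded B E →
  (∀ d t₀ → count B D d t₀ ≡ count B E d t₀) → D ≈ E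
count-injective B {D} {E} bdD bdE same (k , d) =
  (λ m → indicator-1 ((k , d) ∈? E) (trans (sym (χ-same (bdD k d m))) (indicator-yes ((k , d) ∈? D) m))) ,
  (λ m → indicator-1 ((k , d) ∈? D) (trans (χ-same (bdE k d m)) (indicator-yes ((k , d) ∈? E) m)))
  where
  χ-same : k ≤ B → χ D (k , d) ≡ χ E (k , d)
  χ-same k≤B = +-cancelʳ-≡ _ _ _ (begin
    χ D (k , d) + count B D d (suc k) ≡⟨ sym (count-unfold B D d k k≤B) ⟩
    count B D d k                     ≡⟨ same d k ⟩
    count B E d k                     ≡⟨ count-unfold B E d k k≤B ⟩
    χ E (k , d) + count B E d (suc k) ≡⟨ cong (χ E (k , d) +_) (sym (same d (suc k))) ⟩
    χ E (k , d) + count B D d (suc k) ∎)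
    where open ≡-Reasoning

moved-unique : ∀ {r c t D E F} → Moved r c t D E → Moved r c t D F → E ≈ F
moved-unique E-moved F-moved p =
  (λ m → proj₂ (F-moved p) (proj₁ (E-moved p) m)) , (λ m → proj₂ (E-moved p) (proj₁ (F-moved p) m))

-- the counts (d , t₀) lowered by moving (r , c) down to (t , c)
Affected : ℕ → ℕ → ℕ → ℕ → ℕ → Set
Affected r c t d t₀ = d ≡ c × t < t₀ × t₀ ≤ r

affected? : ∀ r c t d t₀ → Dec (Affected r c t d t₀)
affected? r c t d t₀ = (d ≟ c) ×-dec (t <? t₀) ×-dec (t₀ ≤? r)

colSum-δ-unaffected : ∀ B {r c t d t₀} → t < r → r ≤ B → ¬ Affected r c t d t₀ →
  colSum B (δ (t , c)) d t₀ ≡ colSum B (δ (r , c)) d t₀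
colSum-δ-unaffected B {r} {c} {t} {d} {t₀} t<r r≤B unaffected with d ≟ c | t₀ ≤? t
... | no d≢c | _ = trans (colSum-δ-out B t c d t₀ (d≢c ∘ proj₁)) (sym (colSum-δ-out B r c d t₀ (d≢c ∘ proj₁)))
... | yes refl | yes t₀≤t =
  trans (colSum-δ-in B t c t₀ t₀≤t (≤-trans (<⇒≤ t<r) r≤B))
        (sym (colSum-δ-in B r c t₀ (≤-trans t₀≤t (<⇒≤ t<r)) r≤B))
... | yes refl | no t₀≰t = trans (colSum-δ-out B t c d t₀ (λ (_ , t₀≤t) → t₀≰t t₀≤t))
  (sym (colSum-δ-out B r c d t₀ (λ (_ , t₀≤r) → unaffected (refl , ≰⇒> t₀≰t , t₀≤r))))

module _ (B : ℕ) {r c t : ℕ} {D E : Diagram}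
         (cell : (r , c) ∈ D) (free : (t , c) ∉ D) (t<r : t < r) (r≤B : r ≤ B) (moved : Moved r c t D E) where

  private
    count-moved : ∀ d t₀ → count B E d t₀ + colSum B (δ (r , c)) d t₀ ≡ count B D d t₀ + colSum B (δ (t , c)) d t₀
    count-moved d t₀ = begin
      count B E d t₀ + colSum B (δ (r , c)) d t₀
        ≡⟨ sym (sumFrom-+ _ _ t₀ (suc B ∸ t₀)) ⟩
      sumFrom (λ k → χ E (k , d) + δ (r , c) (k , d)) t₀ (suc B ∸ t₀)
        ≡⟨ sumFrom-cong t₀ (suc B ∸ t₀) (λ k → χ-moved cell free t<r moved (k , d)) ⟩
      sumFrom (λ k → χ D (k , d) + δ (t , c) (k , d)) t₀ (suc B ∸ t₀)
        ≡⟨ sumFrom-+ _ _ t₀ (suc B ∸ t₀) ⟩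
      count B D d t₀ + colSum B (δ (t , c)) d t₀ ∎
      where open ≡-Reasoning

  moved-count-affected : ∀ {d t₀} → Affected r c t d t₀ → suc (count B E d t₀) ≡ count B D d t₀
  moved-count-affected {t₀ = t₀} (refl , t<t₀ , t₀≤r) = begin
    suc (count B E c t₀)                   ≡⟨ +-comm 1 _ ⟩
    count B E c t₀ + 1                     ≡⟨ cong (count B E c t₀ +_) (sym (colSum-δ-in B r c t₀ t₀≤r r≤B)) ⟩
    count B E c t₀ + colSum B (δ (r , c)) c t₀ ≡⟨ count-moved c t₀ ⟩
    count B D c t₀ + colSum B (δ (t , c)) c t₀ ≡⟨ cong (count B D c t₀ +_) t-not-counted ⟩
    count B D c t₀ + 0                     ≡⟨ +-identityʳ _ ⟩
    count B D c t₀                         ∎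
    where
    open ≡-Reasoning
    t-not-counted : colSum B (δ (t , c)) c t₀ ≡ 0
    t-not-counted = colSum-δ-out B t c c t₀ (λ (_ , t₀≤t) → <⇒≱ t<t₀ t₀≤t)

  moved-count-unaffected : ∀ {d t₀} → ¬ Affected r c t d t₀ → count B E d t₀ ≡ count B D d t₀
  moved-count-unaffected {d} {t₀} unaffected = +-cancelʳ-≡ _ _ _ (begin
    count B E d t₀ + colSum B (δ (r , c)) d t₀ ≡⟨ count-moved d t₀ ⟩
    count B D d t₀ + colSum B (δ (t , c)) d t₀ ≡⟨ cong (count B D d t₀ +_) (colSum-δ-unaffected B t<r r≤B unaffected) ⟩
    count B D d t₀ + colSum B (δ (r , c)) d t₀ ∎)
    where open ≡-Reasoning

  moved-count-≤ : ∀ d t₀ → count B E d t₀ ≤ count B D d t₀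
  moved-count-≤ d t₀ with affected? r c t d t₀
  ... | yes a = ≤-trans (n≤1+n _) (≤-reflexive (moved-count-affected a))
  ... | no a = ≤-reflexive (moved-count-unaffected a)

⇝*-count-≤ : ∀ B {D E} → D ⇝* E → RowBounded B D → ∀ d t₀ → count B E d t₀ ≤ count B D d t₀
⇝*-count-≤ B (done e) bd d t₀ = ≤-reflexive (sym (count-≈ B e d t₀))
⇝*-count-≤ B (step r (_ , _ , i , _ , _ , t<r , tf , _ , moved) s) bd d t₀ =
  ≤-trans (⇝*-count-≤ B s (moved-rowBounded i t<r moved bd) d t₀) (moved-count-≤ B i tf t<r (bd _ _ i) moved d t₀)

-- Cover moves are covering relations

-- The first step Y ⇝ W of any descent from Y down to X = move r c t Y must
-- lower a count that X lowers too; the gap condition then forces it to be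
-- the cover move itself.
coverMove-first : ∀ {B Y W r c t r'} → RowBounded B Y → CoverMove r c t Y → KohnertMove r' Y W →
  (∀ d t₀ → count B (move r c t Y) d t₀ ≤ count B W d t₀) → W ≈ move r c t Y
coverMove-first {B} {Y} {W} {r} {c} {t} {r'} bd (coverMove i tp _ t<r tf fl ext)
                (c' , t' , i' , tp' , _ , t'<r' , tf' , _ , moved') X≤W
  with same-move
  where
  also-affected : ∀ t₀ → Affected r' c' t' c' t₀ → Affected r c t c' t₀
  also-affected t₀ a with affected? r c t c' t₀
  ... | yes a' = a'
  ... | no na = ⊥-elim (<⇒≱ W<Y (≤-trans (≤-reflexive Y≡X) (X≤W c' t₀)))
    where
    W<Y : count B W c' t₀ < count B Y c' t₀
    W<Y = ≤-reflexive (moved-count-affected B i' tf' t'<r' (bd r' c' i') moved' a)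
    Y≡X : count B Y c' t₀ ≡ count B (move r c t Y) c' t₀
    Y≡X = sym (moved-count-unaffected B i tf t<r (bd r c i) move-Moved na)
  same-move : c' ≡ c × r' ≡ r × t' ≡ t
  same-move with also-affected r' (refl , t'<r' , ≤-refl) | also-affected (suc t') (refl , ≤-refl , t'<r')
  ... | refl , t<r' , r'≤r | _ , t<1+t' , _ = refl , r'≡r , sym t≡t'
    where
    r'≡r : r' ≡ r
    r'≡r with m≤n⇒m<n∨m≡n r'≤r
    ... | inj₂ e = e
    ... | inj₁ r'<r with ext r' t<r' r'<r
    ...   | (c'' , c<c'' , m) = ⊥-elim (<⇒≱ c<c'' (tp' c'' m))
    t≡t' : t ≡ t'
    t≡t' with m≤n⇒m<n∨m≡n (≤-pred t<1+t')
    ... | inj₂ e = e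
    ... | inj₁ t<t' = ⊥-elim (tf' (fl t' t<t' (subst (t' <_) r'≡r t'<r')))
... | refl , refl , refl = moved-unique moved' move-Moved

coverMove-covers : ∀ {D₀ B Y r c t} (πY : D₀ ⇝* Y) (πX : D₀ ⇝* move r c t Y) → RowBounded B Y →
  CoverMove r c t Y → KohnertPoset.Covers D₀ (Y , πY) (move r c t Y , πX)
coverMove-covers {D₀} {B} {Y} {r} {c} {t} πY πX bd g = (Path⇒⇝* (g ◅ ε) , X≉Y) , nothing-between
  where
  open KohnertPoset D₀
  X : Diagram
  X = move r c t Y
  X≉Y : ¬ (X ≈ Y)
  X≉Y e = moved-∉ (CoverMove.target<r g) (move-Moved {D = Y}) (proj₂ (e (r , c)) (CoverMove.cell g))
  nothing-between : ∀ z → ¬ (((X , πX) ≺ z) × (z ≺ (Y , πY)))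
  nothing-between (Z , _) (_ , done e , Z≉Y) = Z≉Y (≈-sym e)
  nothing-between (Z , _) ((Z⇝X , X≉Z) , step {E = W} _ km W⇝Z , _) =
    X≉Z (count-injective B bdX bdZ (λ d t₀ → ≤-antisym (⇝*-count-≤ B Z⇝X bdZ d t₀) (Z≤X d t₀)))
    where
    bdW : RowBounded B W
    bdW = kohnertMove-rowBounded km bd
    bdZ : RowBounded B Z
    bdZ = ⇝*-rowBounded W⇝Z bdW
    bdX : RowBounded B X
    bdX = ⇝*-rowBounded Z⇝X bdZ
    W≈X : W ≈ X
    W≈X = coverMove-first bd g km (λ d t₀ → ≤-trans (⇝*-count-≤ B Z⇝X bdZ d t₀) (⇝*-count-≤ B W⇝Z bdW d t₀))
    Z≤X : ∀ d t₀ → count B Z d t₀ ≤ count B X d t₀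
    Z≤X d t₀ = ≤-trans (⇝*-count-≤ B W⇝Z bdW d t₀) (≤-reflexive (count-≈ B W≈X d t₀))

module RankedPaths {D₀ : Diagram} {B : ℕ} (bd₀ : RowBounded B D₀) (R : KohnertRanked D₀) where

  private
    ρ : KD D₀ → ℕ
    ρ = proj₁ R

    point : ∀ {k Y} → Path k D₀ Y → KD D₀
    point {Y = Y} P = Y , Path⇒⇝* P

    ρ-≈ : ∀ {j k Y Z} (P : Path j D₀ Y) (Q : Path k D₀ Z) → Y ≈ Z → ρ (point P) ≡ ρ (point Q)
    ρ-≈ P Q = proj₁ (proj₂ R) (point P) (point Q)

    ρ-path : ∀ {j k Y X} (P₀ : Path j D₀ Y) (P : Path k Y X) → ρ (point (P₀ ◅◅ P)) + k ≡ ρ (point P₀)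
    ρ-path P₀ ε = trans (+-identityʳ _) (ρ-≈ (P₀ ◅◅ ε) P₀ ≈-refl)
    ρ-path {j} {suc k} {Y} P₀ (_◅_ {r = r} {c} {t} g P) = begin
      ρ (point (P₀ ◅◅ g ◅ P)) + suc k ≡⟨ +-suc _ k ⟩
      suc (ρ (point (P₀ ◅◅ g ◅ P)) + k) ≡⟨ cong (λ n → suc (n + k)) (ρ-≈ (P₀ ◅◅ g ◅ P) (P₁ ◅◅ P) ≈-refl) ⟩
      suc (ρ (point (P₁ ◅◅ P)) + k) ≡⟨ cong suc (ρ-path P₁ P) ⟩
      suc (ρ (point P₁))              ≡⟨ sym (proj₂ (proj₂ (proj₂ R)) (point P₁) (point P₀) covers) ⟩
      ρ (point P₀)                    ∎
      where
      open ≡-Reasoning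
      P₁ : Path (j + 1) D₀ (move r c t Y)
      P₁ = P₀ ◅◅ g ◅ ε
      covers : KohnertPoset.Covers D₀ (point P₀) (point P₁)
      covers = coverMove-covers (Path⇒⇝* P₀) (Path⇒⇝* P₁) (⇝*-rowBounded (Path⇒⇝* P₀) bd₀) g

  path-length-unique : ∀ {j k l Y X₁ X₂} → Path j D₀ Y → Path k Y X₁ → Path l Y X₂ → X₁ ≈ X₂ → k ≡ l
  path-length-unique P₀ P₁ P₂ X₁≈X₂ = +-cancelˡ-≡ _ _ _ (begin
    ρ (point (P₀ ◅◅ P₁)) + _ ≡⟨ ρ-path P₀ P₁ ⟩
    ρ (point P₀)             ≡⟨ sym (ρ-path P₀ P₂) ⟩
    ρ (point (P₀ ◅◅ P₂)) + _ ≡⟨ cong (_+ _) (sym (ρ-≈ (P₀ ◅◅ P₁) (P₀ ◅◅ P₂) X₁≈X₂)) ⟩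
    ρ (point (P₀ ◅◅ P₁)) + _ ∎)
    where open ≡-Reasoning

InSegment : ℕ → ℕ → ℕ → Set
InSegment l h c = l < c × c ≤ h

Shifted : ℕ → ℕ → ℕ → Diagram → Diagram → Set
Shifted l h t D E = ∀ r₀ c₀ → (r₀ , c₀) ∈ E ⇔
  (((r₀ , c₀) ∈ D × ¬ (r₀ ≡ suc t × InSegment l h c₀)) ⊎ (r₀ ≡ t × InSegment l h c₀))

shifted-empty : ∀ {l h t D} → h ≤ l → Shifted l h t D D
shifted-empty h≤l r₀ c₀ = mk⇔
  (λ m → inj₁ (m , λ (_ , l<c , c≤h) → <⇒≱ l<c (≤-trans c≤h h≤l)))
  (λ { (inj₁ (m , _)) → m ; (inj₂ (_ , l<c , c≤h)) → ⊥-elim (<⇒≱ l<c (≤-trans c≤h h≤l)) })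

shifted-step : ∀ {l h t D E} → l ≤ h → Shifted l h t (move (suc t) (suc h) t D) E → Shifted l (suc h) t D E
shifted-step {l} {h} {t} {D} {E} l≤h shifted r₀ c₀ = mk⇔ ⇒ ⇐
  where
  ⇒ : (r₀ , c₀) ∈ E → _
  ⇒ m with to (shifted r₀ c₀) m
  ... | inj₂ (e , l<c , c≤h) = inj₂ (e , l<c , m≤n⇒m≤1+n c≤h)
  ... | inj₁ (m' , outside) with ∈-move⁻ _ m'
  ...   | inj₁ refl = inj₂ (refl , s≤s l≤h , ≤-refl)
  ...   | inj₂ (m'' , ≢top) = inj₁ (m'' , λ (e , l<c , c≤1+h) → not-in-segment e l<c c≤1+h)
    where
    not-in-segment : r₀ ≡ suc t → l < c₀ → c₀ ≤ suc h → ⊥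
    not-in-segment e l<c c≤1+h with c₀ ≤? h
    ... | yes c≤h = outside (e , l<c , c≤h)
    ... | no c≰h = ≢top (cong₂ _,_ e (≤-antisym c≤1+h (≰⇒> c≰h)))
  ⇐ : _ → (r₀ , c₀) ∈ E
  ⇐ (inj₁ (m , outside)) = from (shifted r₀ c₀) (inj₁ (∈-move⁺ {D = D} _ (inj₂ (m , ≢top)) ,
    λ (e , l<c , c≤h) → outside (e , l<c , m≤n⇒m≤1+n c≤h)))
    where
    ≢top : (r₀ , c₀) ≢ (suc t , suc h)
    ≢top refl = outside (refl , s≤s l≤h , ≤-refl)
  ⇐ (inj₂ (e , l<c , c≤1+h)) with c₀ ≤? h
  ... | yes c≤h = from (shifted r₀ c₀) (inj₂ (e , l<c , c≤h))
  ... | no c≰h = from (shifted r₀ c₀)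
    (inj₁ (∈-move⁺ {D = D} _ (inj₁ (cong₂ _,_ e (≤-antisym c≤1+h (≰⇒> c≰h)))) ,
           λ (e' , _) → <-irrefl (trans (sym e) e') ≤-refl))

record Shift (l h t : ℕ) (D : Diagram) : Set where
  field
    result   : Diagram
    steps    : ℕ
    steps+l  : steps + l ≡ h
    path     : Path steps D result
    shifted  : Shifted l h t D result

-- The segment is moved right to left, one adjacent cover move per cell.
shift : ∀ {l t} h D → l ≤ h → 1 ≤ t →
  (∀ c → InSegment l h c → (suc t , c) ∈ D) → (∀ c → (suc t , c) ∈ D → c ≤ h) →
  (∀ c → InSegment l h c → (t , c) ∉ D) → Shift l h t D
shift {l} {t} h D l≤h t≥1 full top empty with m≤n⇒m<n∨m≡n l≤h
... | inj₂ refl = record { result = D ; steps = 0 ; steps+l = refl ; path = ε ; shifted = shifted-empty ≤-refl }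
shift {l} {t} (suc h) D l≤h t≥1 full top empty | inj₁ l<1+h = record
  { result = Shift.result rest
  ; steps = suc (Shift.steps rest)
  ; steps+l = cong suc (Shift.steps+l rest)
  ; path = first ◅ Shift.path rest
  ; shifted = shifted-step (≤-pred l<1+h) (Shift.shifted rest)
  }
  where
  D' : Diagram
  D' = move (suc t) (suc h) t D
  first : CoverMove (suc t) (suc h) t D
  first = adjacentMove (full (suc h) (l<1+h , ≤-refl)) top t≥1 (empty (suc h) (l<1+h , ≤-refl))
  full' : ∀ c → InSegment l h c → (suc t , c) ∈ D'
  full' c (l<c , c≤h) = ∈-move⁺ _ (inj₂ (full c (l<c , m≤n⇒m≤1+n c≤h) , λ e → <-irrefl (cong proj₂ e) (s≤s c≤h)))
  top' : ∀ c → (suc t , c) ∈ D' → c ≤ h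
  top' c m with ∈-move⁻ _ m
  ... | inj₁ e = ⊥-elim (<-irrefl (sym (cong proj₁ e)) ≤-refl)
  ... | inj₂ (m' , ne) = ≤-pred (≤∧≢⇒< (top c m') (λ e → ne (cong (suc t ,_) e)))
  empty' : ∀ c → InSegment l h c → (t , c) ∉ D'
  empty' c (l<c , c≤h) m with ∈-move⁻ _ m
  ... | inj₁ e = <-irrefl (cong proj₂ e) (s≤s c≤h)
  ... | inj₂ (m' , _) = empty c (l<c , m≤n⇒m≤1+n c≤h) m'
  rest : Shift l h t D'
  rest = shift h D' (≤-pred l<1+h) t≥1 full' top' empty'

-- Three-row windows

Pattern : Set₁
Pattern = ℕ → ℕ → Set

OutsideWindow : ℕ → ℕ → Cell → Set
OutsideWindow p x (r₀ , c₀) = c₀ ≤ x ⊎ (∀ k → k ≤ 2 → r₀ ≢ k + p)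

record Windowed (D : Diagram) (p x : ℕ) (w : Pattern) (E : Diagram) : Set where
  field
    outside : ∀ q → OutsideWindow p x q → q ∈ E ⇔ q ∈ D
    inside  : ∀ k → k ≤ 2 → ∀ c → x < c → (k + p , c) ∈ E ⇔ w k c

open Windowed

windowed-self : ∀ {D p x w} → (∀ k → k ≤ 2 → ∀ c → x < c → (k + p , c) ∈ D ⇔ w k c) → Windowed D p x w D
windowed-self inD = record { outside = λ q _ → ⇔-id (q ∈ _) ; inside = inD }

module _ {D E p x w} (W : Windowed D p x w E) {k c} (k≤2 : k ≤ 2) (x<c : x < c) where

  windowed-∈ : w k c → (k + p , c) ∈ E
  windowed-∈ = from (inside W k k≤2 c x<c)

  windowed-∈⁻ : (k + p , c) ∈ E → w k c
  windowed-∈⁻ = to (inside W k k≤2 c x<c)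

  windowed-∉ : ¬ w k c → (k + p , c) ∉ E
  windowed-∉ ¬w m = ¬w (windowed-∈⁻ m)

windowed-rightmost : ∀ {D E p x w} → Windowed D p x w E → ∀ {k c} → k ≤ 2 → x ≤ c →
  (∀ c' → x < c' → w k c' → c' ≤ c) → ∀ c' → (k + p , c') ∈ E → c' ≤ c
windowed-rightmost {x = x} W k≤2 x≤c bound c' m with c' ≤? x
... | yes c'≤x = ≤-trans c'≤x x≤c
... | no c'≰x = bound c' (≰⇒> c'≰x) (windowed-∈⁻ W k≤2 (≰⇒> c'≰x) m)

windowed-≈ : ∀ {D E₁ E₂ p x w} → Windowed D p x w E₁ → Windowed D p x w E₂ → E₁ ≈ E₂
windowed-≈ {D} {E₁} {E₂} {p} {x} W₁ W₂ (r₀ , c₀) = to E₁⇔E₂ , from E₁⇔E₂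
  where
  outside-agree : OutsideWindow p x (r₀ , c₀) → (r₀ , c₀) ∈ E₁ ⇔ (r₀ , c₀) ∈ E₂
  outside-agree o = ⇔-sym (outside W₂ _ o) ⇔-∘ outside W₁ _ o
  inside-agree : ∀ k → k ≤ 2 → r₀ ≡ k + p → x < c₀ → (r₀ , c₀) ∈ E₁ ⇔ (r₀ , c₀) ∈ E₂
  inside-agree k k≤2 refl x<c = ⇔-sym (inside W₂ k k≤2 c₀ x<c) ⇔-∘ inside W₁ k k≤2 c₀ x<c
  E₁⇔E₂ : (r₀ , c₀) ∈ E₁ ⇔ (r₀ , c₀) ∈ E₂
  E₁⇔E₂ with c₀ ≤? x | r₀ ≟ p | r₀ ≟ 1 + p | r₀ ≟ 2 + p
  ... | yes c≤x | _ | _ | _ = outside-agree (inj₁ c≤x)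
  ... | no c≰x | yes e | _ | _ = inside-agree 0 z≤n e (≰⇒> c≰x)
  ... | no c≰x | no _ | yes e | _ = inside-agree 1 (s≤s z≤n) e (≰⇒> c≰x)
  ... | no c≰x | no _ | no _ | yes e = inside-agree 2 ≤-refl e (≰⇒> c≰x)
  ... | no _ | no r≢0 | no r≢1 | no r≢2 = outside-agree (inj₂ r∉window)
    where
    r∉window : ∀ k → k ≤ 2 → r₀ ≢ k + p
    r∉window zero _ = r≢0
    r∉window (suc zero) _ = r≢1
    r∉window (suc (suc zero)) _ = r≢2
    r∉window (suc (suc (suc k))) (s≤s (s≤s ()))

movePattern : Pattern → ℕ → ℕ → ℕ → Pattern
movePattern w kr kt c k c₀ = (k ≡ kt × c₀ ≡ c) ⊎ (w k c₀ × ¬ (k ≡ kr × c₀ ≡ c))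

shiftPattern : Pattern → ℕ → ℕ → ℕ → Pattern
shiftPattern w kt l h k c₀ = (k ≡ kt × InSegment l h c₀) ⊎ (w k c₀ × ¬ (k ≡ suc kt × InSegment l h c₀))

private
  outside-≢ : ∀ {p x q k c} → OutsideWindow p x q → k ≤ 2 → x < c → q ≢ (k + p , c)
  outside-≢ (inj₁ c₀≤x) _ x<c e = <⇒≱ x<c (subst (_≤ _) (cong proj₂ e) c₀≤x)
  outside-≢ {k = k} (inj₂ r∉window) k≤2 _ e = r∉window k k≤2 (cong proj₁ e)

windowed-move : ∀ {D E p x w kr kt c} → Windowed D p x w E → kr ≤ 2 → kt ≤ 2 → x < c →
  Windowed D p x (movePattern w kr kt c) (move (kr + p) c (kt + p) E)
windowed-move {D} {E} {p} {x} {w} {kr} {kt} {c} W kr≤2 kt≤2 x<c = record { outside = outside' ; inside = inside' }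
  where
  outside' : ∀ q → OutsideWindow p x q → q ∈ move (kr + p) c (kt + p) E ⇔ q ∈ D
  outside' q o = mk⇔ ⇒ ⇐
    where
    ⇒ : q ∈ move (kr + p) c (kt + p) E → q ∈ D
    ⇒ m with ∈-move⁻ q m
    ... | inj₁ e = ⊥-elim (outside-≢ o kt≤2 x<c e)
    ... | inj₂ (m' , _) = to (outside W q o) m'
    ⇐ : q ∈ D → q ∈ move (kr + p) c (kt + p) E
    ⇐ m = ∈-move⁺ {D = E} q (inj₂ (from (outside W q o) m , outside-≢ o kr≤2 x<c))
  inside' : ∀ k → k ≤ 2 → ∀ c₀ → x < c₀ → (k + p , c₀) ∈ move (kr + p) c (kt + p) E ⇔ movePattern w kr kt c k c₀
  inside' k k≤2 c₀ x<c₀ = mk⇔ ⇒ ⇐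
    where
    ⇒ : (k + p , c₀) ∈ move (kr + p) c (kt + p) E → movePattern w kr kt c k c₀
    ⇒ m with ∈-move⁻ _ m
    ... | inj₁ e = inj₁ (+-cancelʳ-≡ p _ _ (cong proj₁ e) , cong proj₂ e)
    ... | inj₂ (m' , ne) = inj₂ (to (inside W k k≤2 c₀ x<c₀) m' , λ (a , b) → ne (cong₂ _,_ (cong (_+ p) a) b))
    ⇐ : movePattern w kr kt c k c₀ → (k + p , c₀) ∈ move (kr + p) c (kt + p) E
    ⇐ (inj₁ (a , b)) = ∈-move⁺ {D = E} _ (inj₁ (cong₂ _,_ (cong (_+ p) a) b))
    ⇐ (inj₂ (a , b)) = ∈-move⁺ {D = E} _
      (inj₂ (from (inside W k k≤2 c₀ x<c₀) a , λ e → b (+-cancelʳ-≡ p _ _ (cong proj₁ e) , cong proj₂ e)))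

windowed-shift : ∀ {D E E' p x w kt l h} → Windowed D p x w E → suc kt ≤ 2 → x ≤ l →
  Shifted l h (kt + p) E E' → Windowed D p x (shiftPattern w kt l h) E'
windowed-shift {D} {E} {E'} {p} {x} {w} {kt} {l} {h} W 1+kt≤2 x≤l shifted =
  record { outside = outside' ; inside = inside' }
  where
  outside' : ∀ q → OutsideWindow p x q → q ∈ E' ⇔ q ∈ D
  outside' (r₀ , c₀) o = mk⇔ ⇒ ⇐
    where
    not-shifted : OutsideWindow p x (r₀ , c₀) → r₀ ≡ kt + p ⊎ r₀ ≡ suc kt + p → ¬ InSegment l h c₀
    not-shifted (inj₁ c≤x) _ (l<c , _) = <⇒≱ l<c (≤-trans c≤x x≤l)
    not-shifted (inj₂ r∉window) (inj₁ e) _ = r∉window kt (≤-trans (n≤1+n kt) 1+kt≤2) e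
    not-shifted (inj₂ r∉window) (inj₂ e) _ = r∉window (suc kt) 1+kt≤2 e
    ⇒ : (r₀ , c₀) ∈ E' → (r₀ , c₀) ∈ D
    ⇒ m with to (shifted r₀ c₀) m
    ... | inj₁ (m' , _) = to (outside W _ o) m'
    ... | inj₂ (e , seg) = ⊥-elim (not-shifted o (inj₁ e) seg)
    ⇐ : (r₀ , c₀) ∈ D → (r₀ , c₀) ∈ E'
    ⇐ m = from (shifted r₀ c₀) (inj₁ (from (outside W _ o) m , λ (e , seg) → not-shifted o (inj₂ e) seg))
  inside' : ∀ k → k ≤ 2 → ∀ c₀ → x < c₀ → (k + p , c₀) ∈ E' ⇔ shiftPattern w kt l h k c₀
  inside' k k≤2 c₀ x<c₀ = mk⇔ ⇒ ⇐
    where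
    ⇒ : (k + p , c₀) ∈ E' → shiftPattern w kt l h k c₀
    ⇒ m with to (shifted (k + p) c₀) m
    ... | inj₁ (m' , n) = inj₂ (to (inside W k k≤2 c₀ x<c₀) m' , λ (a , seg) → n (cong (_+ p) a , seg))
    ... | inj₂ (e , seg) = inj₁ (+-cancelʳ-≡ p _ _ e , seg)
    ⇐ : shiftPattern w kt l h k c₀ → (k + p , c₀) ∈ E'
    ⇐ (inj₁ (a , seg)) = from (shifted (k + p) c₀) (inj₂ (cong (_+ p) a , seg))
    ⇐ (inj₂ (a , n)) = from (shifted (k + p) c₀)
      (inj₁ (from (inside W k k≤2 c₀ x<c₀) a , λ (e , seg) → n (+-cancelʳ-≡ p _ _ e , seg)))

Agree : ℕ → Pattern → Pattern → Set
Agree x w w' = ∀ k → k ≤ 2 → ∀ c → x < c → w k c ⇔ w' k c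

windowed-agree : ∀ {D E p x w w'} → Windowed D p x w E → Agree x w w' → Windowed D p x w' E
windowed-agree W w⇔w' = record
  { outside = outside W
  ; inside = λ k k≤2 c x<c → w⇔w' k k≤2 c x<c ⇔-∘ inside W k k≤2 c x<c
  }

record Descent (D : Diagram) (p x : ℕ) (w : Pattern) (k : ℕ) : Set where
  constructor descent
  field
    {end}  : Diagram
    path   : Path k D end
    window : Windowed D p x w end

module _ {D₀ : Diagram} {B : ℕ} (bd₀ : RowBounded B D₀) (R : KohnertRanked D₀) where
  open RankedPaths bd₀ R

  descent-length-unique : ∀ {j k l D p x w} → Path j D₀ D → Descent D p x w k → Descent D p x w l → k ≡ l
  descent-length-unique P₀ (descent P₁ W₁) (descent P₂ W₂) =
    path-length-unique P₀ P₁ P₂ (windowed-≈ W₁ W₂)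

ends : ℕ → ℕ → ℕ → ℕ → ℕ
ends e₀ e₁ e₂ zero = e₀
ends e₀ e₁ e₂ (suc zero) = e₁
ends e₀ e₁ e₂ (suc (suc _)) = e₂

rowsPattern : ℕ → ℕ → ℕ → Pattern
rowsPattern e₀ e₁ e₂ k c = c ≤ ends e₀ e₁ e₂ k

-- Either move (p + 1 , a + 1) down and then shift (a , h] of row p + 2 down,
-- or shift (a + 1 , h] of row p + 2 down and then let (p + 2 , a + 1) jump to
-- row p: both reach the same diagram, with one move fewer on the second way.
module Template₁ {D p x a h} (p≥1 : 1 ≤ p) (x≤a : x ≤ a) (1+a<h : suc a < h)
                 (start : Windowed D p x (rowsPattern x (suc a) h) D) where

  private
    w₀ : Pattern
    w₀ = rowsPattern x (suc a) h
    x<1+a : x < suc a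
    x<1+a = s≤s x≤a
    x≤h : x ≤ h
    x≤h = ≤-trans (m≤n⇒m≤1+n x≤a) (<⇒≤ 1+a<h)

  final : Pattern
  final zero c = c ≡ suc a
  final (suc zero) c = c ≤ h
  final (suc (suc _)) c = c ≤ a

  shiftFirst : Shift (suc a) h (suc p) D
  shiftFirst = shift h D (<⇒≤ 1+a<h) (s≤s z≤n)
    (λ c (1+a<c , c≤h) → windowed-∈ start ≤-refl (<-trans x<1+a 1+a<c) c≤h)
    (windowed-rightmost start ≤-refl x≤h (λ _ _ c≤h → c≤h))
    (λ c (1+a<c , _) → windowed-∉ start (s≤s z≤n) (<-trans x<1+a 1+a<c) (<⇒≱ 1+a<c))

  private
    A-window : Windowed D p x (shiftPattern w₀ 1 (suc a) h) (Shift.result shiftFirst)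
    A-window = windowed-shift start ≤-refl (m≤n⇒m≤1+n x≤a) (Shift.shifted shiftFirst)

    jump : CoverMove (2 + p) (suc a) p (Shift.result shiftFirst)
    jump = jumpMove
      (windowed-∈ A-window ≤-refl x<1+a (inj₂ (<⇒≤ 1+a<h , λ (_ , a<a , _) → <-irrefl refl a<a)))
      (windowed-rightmost A-window ≤-refl (<⇒≤ x<1+a) top)
      p≥1
      (windowed-∉ A-window z≤n x<1+a λ { (inj₁ (() , _)) ; (inj₂ (1+a≤x , _)) → <⇒≱ x<1+a 1+a≤x })
      (windowed-∈ A-window (s≤s z≤n) x<1+a (inj₂ (≤-refl , λ { (() , _) })))
      ≤-refl
      (windowed-∈ A-window (s≤s z≤n) (m≤n⇒m≤1+n x<1+a) (inj₁ (refl , ≤-refl , 1+a<h)))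
      where
      top : ∀ c → x < c → shiftPattern w₀ 1 (suc a) h 2 c → c ≤ suc a
      top c _ (inj₂ (c≤h , unshifted)) with c ≤? suc a
      ... | yes c≤1+a = c≤1+a
      ... | no c≰1+a = ⊥-elim (unshifted (refl , ≰⇒> c≰1+a , c≤h))

    agree-shiftFirst : Agree x (movePattern (shiftPattern w₀ 1 (suc a) h) 2 0 (suc a)) final
    agree-shiftFirst zero _ c x<c = mk⇔
      (λ { (inj₁ (_ , e)) → e ; (inj₂ (inj₂ (c≤x , _) , _)) → ⊥-elim (<⇒≱ x<c c≤x) })
      (λ e → inj₁ (refl , e))
    agree-shiftFirst (suc zero) _ c x<c = mk⇔
      (λ { (inj₂ (inj₁ (_ , _ , c≤h) , _)) → c≤h
         ; (inj₂ (inj₂ (c≤1+a , _) , _)) → ≤-trans c≤1+a (<⇒≤ 1+a<h) })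
      ⇐
      where
      ⇐ : c ≤ h → movePattern (shiftPattern w₀ 1 (suc a) h) 2 0 (suc a) 1 c
      ⇐ c≤h with c ≤? suc a
      ... | yes c≤1+a = inj₂ (inj₂ (c≤1+a , λ { (() , _) }) , λ { (() , _) })
      ... | no c≰1+a = inj₂ (inj₁ (refl , ≰⇒> c≰1+a , c≤h) , λ { (() , _) })
    agree-shiftFirst (suc (suc zero)) _ c x<c = mk⇔ ⇒
      (λ c≤a → inj₂ (inj₂ (≤-trans (m≤n⇒m≤1+n c≤a) (<⇒≤ 1+a<h) ,
                           λ (_ , 1+a<c , _) → <⇒≱ 1+a<c (m≤n⇒m≤1+n c≤a)) ,
                     λ (_ , e) → <⇒≱ (s≤s c≤a) (≤-reflexive (sym e))))
      where
      ⇒ : movePattern (shiftPattern w₀ 1 (suc a) h) 2 0 (suc a) 2 c → c ≤ a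
      ⇒ (inj₂ (inj₂ (c≤h , unshifted) , c≢1+a)) with c ≤? suc a
      ... | yes c≤1+a = ≤-pred (≤∧≢⇒< c≤1+a λ e → c≢1+a (refl , e))
      ... | no c≰1+a = ⊥-elim (unshifted (refl , ≰⇒> c≰1+a , c≤h))
    agree-shiftFirst (suc (suc (suc _))) (s≤s (s≤s ()))

  viaShiftFirst : Descent D p x final (Shift.steps shiftFirst + 1)
  viaShiftFirst = descent (Shift.path shiftFirst ◅◅ jump ◅ ε)
    (windowed-agree (windowed-move A-window ≤-refl z≤n x<1+a) agree-shiftFirst)

  private
    moveFirst : CoverMove (1 + p) (suc a) p D
    moveFirst = adjacentMove (windowed-∈ start (s≤s z≤n) x<1+a ≤-refl)
      (windowed-rightmost start (s≤s z≤n) (<⇒≤ x<1+a) (λ _ _ c≤ → c≤)) p≥1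
      (windowed-∉ start z≤n x<1+a (<⇒≱ x<1+a))

    D₁-window : Windowed D p x (movePattern w₀ 1 0 (suc a)) (move (1 + p) (suc a) p D)
    D₁-window = windowed-move start (s≤s z≤n) z≤n x<1+a

  shiftSecond : Shift a h (suc p) (move (1 + p) (suc a) p D)
  shiftSecond = shift h _ (≤-trans (n≤1+n a) (<⇒≤ 1+a<h)) (s≤s z≤n)
    (λ c (a<c , c≤h) → windowed-∈ D₁-window ≤-refl (≤-<-trans x≤a a<c) (inj₂ (c≤h , λ { (() , _) })))
    (windowed-rightmost D₁-window ≤-refl x≤h λ { _ _ (inj₂ (c≤h , _)) → c≤h })
    empty
    where
    empty : ∀ c → InSegment a h c → (suc p , c) ∉ move (1 + p) (suc a) p D
    empty c (a<c , _) m with windowed-∈⁻ D₁-window (s≤s z≤n) (≤-<-trans x≤a a<c) m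
    ... | inj₂ (c≤1+a , c≢1+a) = c≢1+a (refl , ≤-antisym c≤1+a a<c)

  private
    agree-moveFirst : Agree x (shiftPattern (movePattern w₀ 1 0 (suc a)) 1 a h) final
    agree-moveFirst zero _ c x<c = mk⇔
      (λ { (inj₂ (inj₁ (_ , e) , _)) → e ; (inj₂ (inj₂ (c≤x , _) , _)) → ⊥-elim (<⇒≱ x<c c≤x) })
      (λ e → inj₂ (inj₁ (refl , e) , λ { (() , _) }))
    agree-moveFirst (suc zero) _ c x<c = mk⇔
      (λ { (inj₁ (_ , _ , c≤h)) → c≤h ; (inj₂ (inj₂ (c≤1+a , _) , _)) → ≤-trans c≤1+a (<⇒≤ 1+a<h) })
      ⇐
      where
      ⇐ : c ≤ h → shiftPattern (movePattern w₀ 1 0 (suc a)) 1 a h 1 c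
      ⇐ c≤h with c ≤? a
      ... | yes c≤a = inj₂ (inj₂ (m≤n⇒m≤1+n c≤a , λ (_ , e) → <⇒≱ (s≤s c≤a) (≤-reflexive (sym e))) , λ { (() , _) })
      ... | no c≰a = inj₁ (refl , ≰⇒> c≰a , c≤h)
    agree-moveFirst (suc (suc zero)) _ c x<c = mk⇔ ⇒
      (λ c≤a → inj₂ (inj₂ (≤-trans (m≤n⇒m≤1+n c≤a) (<⇒≤ 1+a<h) , λ { (() , _) }) ,
                     λ (_ , a<c , _) → <⇒≱ a<c c≤a))
      where
      ⇒ : shiftPattern (movePattern w₀ 1 0 (suc a)) 1 a h 2 c → c ≤ a
      ⇒ (inj₂ (inj₂ (c≤h , _) , unshifted)) with c ≤? a
      ... | yes c≤a = c≤a
      ... | no c≰a = ⊥-elim (unshifted (refl , ≰⇒> c≰a , c≤h))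
    agree-moveFirst (suc (suc (suc _))) (s≤s (s≤s ()))

  viaMoveFirst : Descent D p x final (suc (Shift.steps shiftSecond))
  viaMoveFirst = descent (moveFirst ◅ Shift.path shiftSecond)
    (windowed-agree (windowed-shift D₁-window ≤-refl x≤a (Shift.shifted shiftSecond)) agree-moveFirst)

  lengths-differ : Shift.steps shiftFirst + 1 ≢ suc (Shift.steps shiftSecond)
  lengths-differ e = <-irrefl (trans (suc-injective (trans (+-comm 1 _) e)) second≡1+first) (n<1+n _)
    where
    second≡1+first : Shift.steps shiftSecond ≡ suc (Shift.steps shiftFirst)
    second≡1+first = +-cancelʳ-≡ a _ _ (trans (Shift.steps+l shiftSecond)
      (trans (sym (Shift.steps+l shiftFirst)) (+-suc _ a)))

-- Either let (p + 2 , b + 1) jump to row p and then shift (b + 1 , a] of row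
-- p + 1 down, or shift (b , a] of row p + 1 down and then move (p + 2 , b + 1)
-- down: the first way is one move shorter.
module Template₂ {D p x a b} (p≥1 : 1 ≤ p) (x≤b : x ≤ b) (1+b<a : suc b < a)
                 (start : Windowed D p x (rowsPattern x a (suc b)) D) where

  private
    w₀ : Pattern
    w₀ = rowsPattern x a (suc b)
    x<1+b : x < suc b
    x<1+b = s≤s x≤b
    x≤a : x ≤ a
    x≤a = ≤-trans (m≤n⇒m≤1+n x≤b) (<⇒≤ 1+b<a)

  final : Pattern
  final zero c = InSegment b a c
  final (suc zero) c = c ≤ suc b
  final (suc (suc _)) c = c ≤ b

  private
    jump : CoverMove (2 + p) (suc b) p D
    jump = jumpMove (windowed-∈ start ≤-refl x<1+b ≤-refl)
      (windowed-rightmost start ≤-refl (<⇒≤ x<1+b) (λ _ _ c≤ → c≤)) p≥1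
      (windowed-∉ start z≤n x<1+b (<⇒≱ x<1+b))
      (windowed-∈ start (s≤s z≤n) x<1+b (<⇒≤ 1+b<a))
      ≤-refl
      (windowed-∈ start (s≤s z≤n) (m≤n⇒m≤1+n x<1+b) 1+b<a)

    J-window : Windowed D p x (movePattern w₀ 2 0 (suc b)) (move (2 + p) (suc b) p D)
    J-window = windowed-move start ≤-refl z≤n x<1+b

  shiftAfterJump : Shift (suc b) a p (move (2 + p) (suc b) p D)
  shiftAfterJump = shift a _ (<⇒≤ 1+b<a) p≥1
    (λ c (1+b<c , c≤a) → windowed-∈ J-window (s≤s z≤n) (<-trans x<1+b 1+b<c) (inj₂ (c≤a , λ { (() , _) })))
    (windowed-rightmost J-window (s≤s z≤n) x≤a λ { _ _ (inj₁ (() , _)) ; _ _ (inj₂ (c≤a , _)) → c≤a })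
    empty
    where
    empty : ∀ c → InSegment (suc b) a c → (p , c) ∉ move (2 + p) (suc b) p D
    empty c (1+b<c , _) m with windowed-∈⁻ J-window z≤n (<-trans x<1+b 1+b<c) m
    ... | inj₁ (_ , refl) = <-irrefl refl 1+b<c
    ... | inj₂ (c≤x , _) = <⇒≱ (<-trans x<1+b 1+b<c) c≤x

  private
    agree-jumpFirst : Agree x (shiftPattern (movePattern w₀ 2 0 (suc b)) 0 (suc b) a) final
    agree-jumpFirst zero _ c x<c = mk⇔
      (λ { (inj₁ (_ , 1+b<c , c≤a)) → <⇒≤ 1+b<c , c≤a
         ; (inj₂ (inj₁ (_ , refl) , _)) → ≤-refl , <⇒≤ 1+b<a
         ; (inj₂ (inj₂ (c≤x , _) , _)) → ⊥-elim (<⇒≱ x<c c≤x) })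
      ⇐
      where
      ⇐ : InSegment b a c → shiftPattern (movePattern w₀ 2 0 (suc b)) 0 (suc b) a 0 c
      ⇐ (b<c , c≤a) with m≤n⇒m<n∨m≡n b<c
      ... | inj₁ 1+b<c = inj₁ (refl , 1+b<c , c≤a)
      ... | inj₂ refl = inj₂ (inj₁ (refl , refl) , λ { (() , _) })
    agree-jumpFirst (suc zero) _ c x<c = mk⇔ ⇒
      (λ c≤1+b → inj₂ (inj₂ (≤-trans c≤1+b (<⇒≤ 1+b<a) , λ { (() , _) }) , λ (_ , 1+b<c , _) → <⇒≱ 1+b<c c≤1+b))
      where
      ⇒ : shiftPattern (movePattern w₀ 2 0 (suc b)) 0 (suc b) a 1 c → c ≤ suc b
      ⇒ (inj₂ (inj₂ (c≤a , _) , unshifted)) with c ≤? suc b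
      ... | yes c≤1+b = c≤1+b
      ... | no c≰1+b = ⊥-elim (unshifted (refl , ≰⇒> c≰1+b , c≤a))
    agree-jumpFirst (suc (suc zero)) _ c x<c = mk⇔
      (λ { (inj₁ (() , _)) ; (inj₂ (inj₁ (() , _) , _))
         ; (inj₂ (inj₂ (c≤1+b , c≢1+b) , _)) → ≤-pred (≤∧≢⇒< c≤1+b λ e → c≢1+b (refl , e)) })
      (λ c≤b → inj₂ (inj₂ (m≤n⇒m≤1+n c≤b , λ (_ , e) → <⇒≱ (s≤s c≤b) (≤-reflexive (sym e))) , λ { (() , _) }))
    agree-jumpFirst (suc (suc (suc _))) (s≤s (s≤s ()))

  viaJumpFirst : Descent D p x final (suc (Shift.steps shiftAfterJump))
  viaJumpFirst = descent (jump ◅ Shift.path shiftAfterJump)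
    (windowed-agree (windowed-shift J-window (s≤s z≤n) (<⇒≤ x<1+b) (Shift.shifted shiftAfterJump)) agree-jumpFirst)

  shiftFirst : Shift b a p D
  shiftFirst = shift a D (≤-trans (n≤1+n b) (<⇒≤ 1+b<a)) p≥1
    (λ c (b<c , c≤a) → windowed-∈ start (s≤s z≤n) (≤-<-trans x≤b b<c) c≤a)
    (windowed-rightmost start (s≤s z≤n) x≤a (λ _ _ c≤a → c≤a))
    (λ c (b<c , _) → windowed-∉ start z≤n (≤-<-trans x≤b b<c) (<⇒≱ (≤-<-trans x≤b b<c)))

  private
    F-window : Windowed D p x (shiftPattern w₀ 0 b a) (Shift.result shiftFirst)
    F-window = windowed-shift start (s≤s z≤n) x≤b (Shift.shifted shiftFirst)

    lastMove : CoverMove (2 + p) (suc b) (1 + p) (Shift.result shiftFirst)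
    lastMove = adjacentMove (windowed-∈ F-window ≤-refl x<1+b (inj₂ (≤-refl , λ { (() , _) })))
      (windowed-rightmost F-window ≤-refl (<⇒≤ x<1+b) λ { _ _ (inj₂ (c≤1+b , _)) → c≤1+b })
      (s≤s z≤n)
      (windowed-∉ F-window (s≤s z≤n) x<1+b λ { (inj₂ (_ , unshifted)) → unshifted (refl , ≤-refl , <⇒≤ 1+b<a) })

    agree-shiftFirst : Agree x (movePattern (shiftPattern w₀ 0 b a) 2 1 (suc b)) final
    agree-shiftFirst zero _ c x<c = mk⇔
      (λ { (inj₂ (inj₁ (_ , seg) , _)) → seg ; (inj₂ (inj₂ (c≤x , _) , _)) → ⊥-elim (<⇒≱ x<c c≤x) })
      (λ seg → inj₂ (inj₁ (refl , seg) , λ { (() , _) }))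
    agree-shiftFirst (suc zero) _ c x<c = mk⇔
      (λ { (inj₁ (_ , refl)) → ≤-refl ; (inj₂ (inj₂ (c≤a , unshifted) , _)) → not-shifted c≤a unshifted })
      ⇐
      where
      not-shifted : c ≤ a → ¬ (1 ≡ 1 × InSegment b a c) → c ≤ suc b
      not-shifted c≤a unshifted with c ≤? b
      ... | yes c≤b = m≤n⇒m≤1+n c≤b
      ... | no c≰b = ⊥-elim (unshifted (refl , ≰⇒> c≰b , c≤a))
      ⇐ : c ≤ suc b → movePattern (shiftPattern w₀ 0 b a) 2 1 (suc b) 1 c
      ⇐ c≤1+b with m≤n⇒m<n∨m≡n c≤1+b
      ... | inj₂ e = inj₁ (refl , e)
      ... | inj₁ c<1+b = inj₂ (inj₂ (≤-trans (<⇒≤ c<1+b) (<⇒≤ 1+b<a) ,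
                                   λ (_ , b<c , _) → <⇒≱ b<c (≤-pred c<1+b)) , λ { (() , _) })
    agree-shiftFirst (suc (suc zero)) _ c x<c = mk⇔
      (λ { (inj₁ (() , _)) ; (inj₂ (inj₁ (() , _) , _))
         ; (inj₂ (inj₂ (c≤1+b , _) , c≢1+b)) → ≤-pred (≤∧≢⇒< c≤1+b λ e → c≢1+b (refl , e)) })
      (λ c≤b → inj₂ (inj₂ (m≤n⇒m≤1+n c≤b , λ { (() , _) }) , λ (_ , e) → <⇒≱ (s≤s c≤b) (≤-reflexive (sym e))))
    agree-shiftFirst (suc (suc (suc _))) (s≤s (s≤s ()))

  viaShiftFirst : Descent D p x final (Shift.steps shiftFirst + 1)
  viaShiftFirst = descent (Shift.path shiftFirst ◅◅ lastMove ◅ ε)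
    (windowed-agree (windowed-move F-window ≤-refl (s≤s z≤n) x<1+b) agree-shiftFirst)

  lengths-differ : suc (Shift.steps shiftAfterJump) ≢ Shift.steps shiftFirst + 1
  lengths-differ e = <-irrefl (trans (suc-injective (trans e (+-comm _ 1))) first≡1+second) (n<1+n _)
    where
    first≡1+second : Shift.steps shiftFirst ≡ suc (Shift.steps shiftAfterJump)
    first≡1+second = +-cancelʳ-≡ b _ _ (trans (Shift.steps+l shiftFirst)
      (trans (sym (Shift.steps+l shiftAfterJump)) (+-suc _ b)))

-- Moving (p + 1 , u + 1), (p + 2 , u + 1) down and letting (p + 2 , u) jump
-- to row p takes three moves; moving (p + 1 , u + 1), (p + 1 , u) down and
-- then (p + 2 , u + 1), (p + 2 , u) down takes four, to the same diagram.
module Template₃ {D p x u} (p≥1 : 1 ≤ p) (x<u : x < u)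
                 (start : Windowed D p x (rowsPattern x (suc u) (suc u)) D) where

  private
    w₀ : Pattern
    w₀ = rowsPattern x (suc u) (suc u)
    x<1+u : x < suc u
    x<1+u = m≤n⇒m≤1+n x<u
    u≢1+u : u ≢ suc u
    u≢1+u = <⇒≢ (n<1+n u)

    below-1+u : ∀ {c} → c ≤ suc u → c ≢ suc u → c ≤ u
    below-1+u c≤1+u c≢1+u = ≤-pred (≤∧≢⇒< c≤1+u c≢1+u)

  final : Pattern
  final zero c = u ≤ c × c ≤ suc u
  final (suc zero) c = c ≤ suc u
  final (suc (suc _)) c = c < u

  private
    first : CoverMove (1 + p) (suc u) p D
    first = adjacentMove (windowed-∈ start (s≤s z≤n) x<1+u ≤-refl)
      (windowed-rightmost start (s≤s z≤n) (<⇒≤ x<1+u) (λ _ _ c≤ → c≤)) p≥1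
      (windowed-∉ start z≤n x<1+u (<⇒≱ x<1+u))

    D₁ : Diagram
    D₁ = move (1 + p) (suc u) p D
    w₁ : Pattern
    w₁ = movePattern w₀ 1 0 (suc u)
    W₁ : Windowed D p x w₁ D₁
    W₁ = windowed-move start (s≤s z≤n) z≤n x<1+u

    second : CoverMove (2 + p) (suc u) (1 + p) D₁
    second = adjacentMove (windowed-∈ W₁ ≤-refl x<1+u (inj₂ (≤-refl , λ { (() , _) })))
      (windowed-rightmost W₁ ≤-refl (<⇒≤ x<1+u) λ { _ _ (inj₁ (() , _)) ; _ _ (inj₂ (c≤ , _)) → c≤ })
      (s≤s z≤n)
      (windowed-∉ W₁ (s≤s z≤n) x<1+u λ { (inj₁ (() , _)) ; (inj₂ (_ , moved)) → moved (refl , refl) })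

    D₂ : Diagram
    D₂ = move (2 + p) (suc u) (1 + p) D₁
    w₂ : Pattern
    w₂ = movePattern w₁ 2 1 (suc u)
    W₂ : Windowed D p x w₂ D₂
    W₂ = windowed-move W₁ ≤-refl (s≤s z≤n) x<1+u

    jump : CoverMove (2 + p) u p D₂
    jump = jumpMove
      (windowed-∈ W₂ ≤-refl x<u (inj₂ (inj₂ (n≤1+n u , λ { (() , _) }) , λ (_ , e) → u≢1+u e)))
      (windowed-rightmost W₂ ≤-refl (<⇒≤ x<u) top) p≥1
      (windowed-∉ W₂ z≤n x<u λ { (inj₁ (() , _)) ; (inj₂ (inj₁ (_ , e) , _)) → u≢1+u e
                               ; (inj₂ (inj₂ (u≤x , _) , _)) → <⇒≱ x<u u≤x })
      (windowed-∈ W₂ (s≤s z≤n) x<u (inj₂ (inj₂ (n≤1+n u , λ (_ , e) → u≢1+u e) , λ { (() , _) })))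
      (n<1+n u)
      (windowed-∈ W₂ (s≤s z≤n) x<1+u (inj₁ (refl , refl)))
      where
      top : ∀ c → x < c → w₂ 2 c → c ≤ u
      top c _ (inj₂ (inj₂ (c≤1+u , _) , moved)) = below-1+u c≤1+u (λ e → moved (refl , e))
      top c _ (inj₁ (() , _))
      top c _ (inj₂ (inj₁ (() , _) , _))

    agree-jump : Agree x (movePattern w₂ 2 0 u) final
    agree-jump zero _ c x<c = mk⇔
      (λ { (inj₁ (_ , refl)) → ≤-refl , n≤1+n u
         ; (inj₂ (inj₂ (inj₁ (_ , refl) , _) , _)) → n≤1+n u , ≤-refl
         ; (inj₂ (inj₂ (inj₂ (c≤x , _) , _) , _)) → ⊥-elim (<⇒≱ x<c c≤x)
         ; (inj₂ (inj₁ (() , _) , _)) })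
      ⇐
      where
      ⇐ : final 0 c → movePattern w₂ 2 0 u 0 c
      ⇐ (u≤c , c≤1+u) with m≤n⇒m<n∨m≡n u≤c
      ... | inj₂ refl = inj₁ (refl , refl)
      ... | inj₁ u<c = inj₂ (inj₂ (inj₁ (refl , ≤-antisym c≤1+u u<c) , λ { (() , _) }) , λ { (() , _) })
    agree-jump (suc zero) _ c x<c = mk⇔
      (λ { (inj₂ (inj₁ (_ , refl) , _)) → ≤-refl
         ; (inj₂ (inj₂ (inj₂ (c≤1+u , _) , _) , _)) → c≤1+u
         ; (inj₁ (() , _)) ; (inj₂ (inj₂ (inj₁ (() , _) , _) , _)) })
      ⇐
      where
      ⇐ : c ≤ suc u → movePattern w₂ 2 0 u 1 c
      ⇐ c≤1+u with c ≟ suc u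
      ... | yes e = inj₂ (inj₁ (refl , e) , λ { (() , _) })
      ... | no c≢1+u = inj₂ (inj₂ (inj₂ (c≤1+u , λ (_ , e) → c≢1+u e) , λ { (() , _) }) , λ { (() , _) })
    agree-jump (suc (suc zero)) _ c x<c = mk⇔
      (λ { (inj₂ (inj₂ (inj₂ (c≤1+u , _) , moved₁) , moved₀)) →
             ≤∧≢⇒< (below-1+u c≤1+u (λ e → moved₁ (refl , e))) (λ e → moved₀ (refl , e))
         ; (inj₁ (() , _)) ; (inj₂ (inj₁ (() , _) , _)) ; (inj₂ (inj₂ (inj₁ (() , _) , _) , _)) })
      (λ c<u → inj₂ (inj₂ (inj₂ (≤-trans (<⇒≤ c<u) (n≤1+n u) , λ { (() , _) }) ,
                            λ (_ , e) → <⇒≱ c<u (≤-trans (n≤1+n u) (≤-reflexive (sym e)))) ,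
                      λ (_ , e) → <-irrefl e c<u))
    agree-jump (suc (suc (suc _))) (s≤s (s≤s ()))

  viaJump : Descent D p x final 3
  viaJump = descent (first ◅ second ◅ jump ◅ ε) (windowed-agree (windowed-move W₂ ≤-refl z≤n x<u) agree-jump)

  private
    second′ : CoverMove (1 + p) u p D₁
    second′ = adjacentMove (windowed-∈ W₁ (s≤s z≤n) x<u (inj₂ (n≤1+n u , λ (_ , e) → u≢1+u e)))
      (windowed-rightmost W₁ (s≤s z≤n) (<⇒≤ x<u) top) p≥1
      (windowed-∉ W₁ z≤n x<u λ { (inj₁ (_ , e)) → u≢1+u e ; (inj₂ (u≤x , _)) → <⇒≱ x<u u≤x })
      where
      top : ∀ c → x < c → w₁ 1 c → c ≤ u
      top c _ (inj₂ (c≤1+u , moved)) = below-1+u c≤1+u (λ e → moved (refl , e))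
      top c _ (inj₁ (() , _))

    D₂′ : Diagram
    D₂′ = move (1 + p) u p D₁
    v₂ : Pattern
    v₂ = movePattern w₁ 1 0 u
    V₂ : Windowed D p x v₂ D₂′
    V₂ = windowed-move W₁ (s≤s z≤n) z≤n x<u

    third′ : CoverMove (2 + p) (suc u) (1 + p) D₂′
    third′ = adjacentMove (windowed-∈ V₂ ≤-refl x<1+u (inj₂ (inj₂ (≤-refl , λ { (() , _) }) , λ { (() , _) })))
      (windowed-rightmost V₂ ≤-refl (<⇒≤ x<1+u)
        λ { _ _ (inj₂ (inj₂ (c≤ , _) , _)) → c≤ ; _ _ (inj₁ (() , _)) ; _ _ (inj₂ (inj₁ (() , _) , _)) })
      (s≤s z≤n)
      (windowed-∉ V₂ (s≤s z≤n) x<1+u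
        λ { (inj₂ (inj₂ (_ , moved) , _)) → moved (refl , refl) ; (inj₁ (() , _)) ; (inj₂ (inj₁ (() , _) , _)) })

    D₃′ : Diagram
    D₃′ = move (2 + p) (suc u) (1 + p) D₂′
    v₃ : Pattern
    v₃ = movePattern v₂ 2 1 (suc u)
    V₃ : Windowed D p x v₃ D₃′
    V₃ = windowed-move V₂ ≤-refl (s≤s z≤n) x<1+u

    fourth′ : CoverMove (2 + p) u (1 + p) D₃′
    fourth′ = adjacentMove
      (windowed-∈ V₃ ≤-refl x<u (inj₂ (inj₂ (inj₂ (n≤1+n u , λ { (() , _) }) , λ { (() , _) }) , λ (_ , e) → u≢1+u e)))
      (windowed-rightmost V₃ ≤-refl (<⇒≤ x<u) top)
      (s≤s z≤n)
      (windowed-∉ V₃ (s≤s z≤n) x<u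
        λ { (inj₁ (_ , e)) → u≢1+u e ; (inj₂ (inj₂ (_ , moved) , _)) → moved (refl , refl) ; (inj₂ (inj₁ (() , _) , _)) })
      where
      top : ∀ c → x < c → v₃ 2 c → c ≤ u
      top c _ (inj₂ (inj₂ (inj₂ (c≤1+u , _) , _) , moved)) = below-1+u c≤1+u (λ e → moved (refl , e))
      top c _ (inj₁ (() , _))
      top c _ (inj₂ (inj₁ (() , _) , _))
      top c _ (inj₂ (inj₂ (inj₁ (() , _) , _) , _))

    agree-four : Agree x (movePattern v₃ 2 1 u) final
    agree-four zero _ c x<c = mk⇔
      (λ { (inj₂ (inj₂ (inj₁ (_ , refl) , _) , _)) → ≤-refl , n≤1+n u
         ; (inj₂ (inj₂ (inj₂ (inj₁ (_ , refl) , _) , _) , _)) → n≤1+n u , ≤-refl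
         ; (inj₂ (inj₂ (inj₂ (inj₂ (c≤x , _) , _) , _) , _)) → ⊥-elim (<⇒≱ x<c c≤x)
         ; (inj₁ (() , _)) ; (inj₂ (inj₁ (() , _) , _)) })
      ⇐
      where
      ⇐ : final 0 c → movePattern v₃ 2 1 u 0 c
      ⇐ (u≤c , c≤1+u) with m≤n⇒m<n∨m≡n u≤c
      ... | inj₂ refl = inj₂ (inj₂ (inj₁ (refl , refl) , λ { (() , _) }) , λ { (() , _) })
      ... | inj₁ u<c = inj₂ (inj₂ (inj₂ (inj₁ (refl , ≤-antisym c≤1+u u<c) , λ { (() , _) }) , λ { (() , _) }) ,
                             λ { (() , _) })
    agree-four (suc zero) _ c x<c = mk⇔
      (λ { (inj₁ (_ , refl)) → n≤1+n u
         ; (inj₂ (inj₁ (_ , refl) , _)) → ≤-refl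
         ; (inj₂ (inj₂ (inj₂ (inj₂ (c≤1+u , _) , _) , _) , _)) → c≤1+u
         ; (inj₂ (inj₂ (inj₁ (() , _) , _) , _)) ; (inj₂ (inj₂ (inj₂ (inj₁ (() , _) , _) , _) , _)) })
      ⇐
      where
      ⇐ : c ≤ suc u → movePattern v₃ 2 1 u 1 c
      ⇐ c≤1+u with c ≟ u | c ≟ suc u
      ... | yes e | _ = inj₁ (refl , e)
      ... | no _ | yes e = inj₂ (inj₁ (refl , e) , λ { (() , _) })
      ... | no c≢u | no c≢1+u = inj₂ (inj₂ (inj₂ (inj₂ (c≤1+u , λ (_ , e) → c≢1+u e) , λ (_ , e) → c≢u e) ,
                                          λ { (() , _) }) , λ { (() , _) })
    agree-four (suc (suc zero)) _ c x<c = mk⇔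
      (λ { (inj₂ (inj₂ (inj₂ (inj₂ (c≤1+u , _) , _) , moved₁) , moved₀)) →
             ≤∧≢⇒< (below-1+u c≤1+u (λ e → moved₁ (refl , e))) (λ e → moved₀ (refl , e))
         ; (inj₁ (() , _)) ; (inj₂ (inj₁ (() , _) , _)) ; (inj₂ (inj₂ (inj₁ (() , _) , _) , _))
         ; (inj₂ (inj₂ (inj₂ (inj₁ (() , _) , _) , _) , _)) })
      (λ c<u → inj₂ (inj₂ (inj₂ (inj₂ (≤-trans (<⇒≤ c<u) (n≤1+n u) , λ { (() , _) }) , λ { (() , _) }) ,
                            λ (_ , e) → <⇒≱ c<u (≤-trans (n≤1+n u) (≤-reflexive (sym e)))) ,
                      λ (_ , e) → <-irrefl e c<u))
    agree-four (suc (suc (suc _))) (s≤s (s≤s ()))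

  viaFourMoves : Descent D p x final 4
  viaFourMoves = descent (first ◅ second′ ◅ third′ ◅ fourth′ ◅ ε)
    (windowed-agree (windowed-move V₃ ≤-refl (s≤s z≤n) x<u) agree-four)

-- A triple of row lengths a₁, a₁ + V, a₁ + z violating purity.
Violation : ℕ → ℕ → Set
Violation V z = (1 ≤ V × 1 ≤ z × V ≢ z) ⊎ (2 ≤ V × V ≡ z)

violation? : ∀ V z → Dec (Violation V z)
violation? V z = (1 ≤? V ×-dec 1 ≤? z ×-dec ¬? (V ≟ z)) ⊎-dec (2 ≤? V ×-dec V ≟ z)

violation-left≥1 : ∀ {V z} → Violation V z → 1 ≤ V
violation-left≥1 (inj₁ (V≥1 , _)) = V≥1
violation-left≥1 (inj₂ (V≥2 , _)) = ≤-trans (s≤s z≤n) V≥2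

violation-right≥1 : ∀ {V z} → Violation V z → 1 ≤ z
violation-right≥1 (inj₁ (_ , z≥1 , _)) = z≥1
violation-right≥1 (inj₂ (V≥2 , refl)) = ≤-trans (s≤s z≤n) V≥2

no-violation : ∀ {V z} → 1 ≤ V → 1 ≤ z → ¬ Violation V z → V ≡ 1 × z ≡ 1
no-violation {V} {z} V≥1 z≥1 ¬violation with V ≟ z
... | no V≢z = ⊥-elim (¬violation (inj₁ (V≥1 , z≥1 , V≢z)))
... | yes refl with 2 ≤? V
...   | yes V≥2 = ⊥-elim (¬violation (inj₂ (V≥2 , refl)))
...   | no V≱2 = V≡1 , V≡1
  where
  V≡1 : V ≡ 1
  V≡1 = ≤-antisym (≤-pred (≰⇒> V≱2)) V≥1

module _ {D₀ : Diagram} {B : ℕ} (bd₀ : RowBounded B D₀) (R : KohnertRanked D₀) where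

  violation-unranked : ∀ {j D p x V z} → Path j D₀ D → 1 ≤ p →
    Windowed D p x (rowsPattern x (x + V) (x + z)) D → Violation V z → ⊥
  violation-unranked {V = zero} _ _ _ (inj₁ (() , _))
  violation-unranked {V = zero} _ _ _ (inj₂ (() , _))
  violation-unranked {V = suc zero} _ _ _ (inj₂ (s≤s () , _))
  violation-unranked {V = suc v} {zero} _ _ _ (inj₁ (_ , () , _))
  violation-unranked {D = D} {p} {x} {suc v} {suc u} P₀ p≥1 start (inj₁ (_ , _ , V≢z)) with <-cmp v u
  ... | tri≈ _ refl _ = V≢z refl
  ... | tri< v<u _ _ = T.lengths-differ (descent-length-unique bd₀ R P₀ T.viaShiftFirst T.viaMoveFirst)
    where
    module T = Template₁ p≥1 (m≤m+n x v) (subst (_< x + suc u) (+-suc x v) (+-monoʳ-< x (s≤s v<u)))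
      (subst (λ e → Windowed D p x (rowsPattern x e (x + suc u)) D) (+-suc x v) start)
  ... | tri> _ _ u<v = T.lengths-differ (descent-length-unique bd₀ R P₀ T.viaJumpFirst T.viaShiftFirst)
    where
    module T = Template₂ p≥1 (m≤m+n x u) (subst (_< x + suc v) (+-suc x u) (+-monoʳ-< x (s≤s u<v)))
      (subst (λ e → Windowed D p x (rowsPattern x (x + suc v) e) D) (+-suc x u) start)
  violation-unranked {D = D} {p} {x} {suc (suc u)} P₀ p≥1 start (inj₂ (_ , refl)) =
    case descent-length-unique bd₀ R P₀ T.viaJump T.viaFourMoves of λ ()
    where
    module T = Template₃ p≥1 (m<m+n x {suc u} (s≤s z≤n))
      (subst (λ e → Windowed D p x (rowsPattern x e e) D) (+-suc x (suc u)) start)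

record Rows (D : Diagram) (p x m : ℕ) (b : ℕ → ℕ) (z : ℕ) : Set where
  field
    lower : ∀ k → k < m → ∀ c → x < c → (k + p , c) ∈ D ⇔ c ≤ x + b k
    top   : ∀ c → x < c → (m + p , c) ∈ D ⇔ c ≤ x + z

open Rows

private
  ∈-row-≡ : ∀ {D : Diagram} {r r' c : ℕ} {P : Set} → r ≡ r' → (r , c) ∈ D ⇔ P → (r' , c) ∈ D ⇔ P
  ∈-row-≡ refl e = e

  not-right-of : ∀ {x c} → x < c → ¬ (c ≤ x + 0)
  not-right-of {x} x<c c≤x+0 = <⇒≱ x<c (subst (_ ≤_) (+-identityʳ x) c≤x+0)

rows-windowed : ∀ {D p x b z} → Rows D p x 2 b z → b 0 ≡ 0 → Windowed D p x (rowsPattern x (x + b 1) (x + z)) D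
rows-windowed {D} {p} {x} {b} {z} rows b₀≡0 = windowed-self window
  where
  window : ∀ k → k ≤ 2 → ∀ c → x < c → (k + p , c) ∈ D ⇔ rowsPattern x (x + b 1) (x + z) k c
  window zero _ c x<c = mk⇔
    (λ m → ⊥-elim (not-right-of x<c (subst (λ e → c ≤ x + e) b₀≡0 (to (lower rows 0 (s≤s z≤n) c x<c) m))))
    (λ c≤x → ⊥-elim (<⇒≱ x<c c≤x))
  window (suc zero) _ = lower rows 1 ≤-refl
  window (suc (suc zero)) _ = top rows
  window (suc (suc (suc _))) (s≤s (s≤s ()))

rows-raise : ∀ {D p x m b z} → Rows D p x (suc m) b z → Rows D (suc p) x m (λ k → b (suc k)) z
rows-raise {D} {p} {x} {m} rows = record
  { lower = λ k k<m c x<c → ∈-row-≡ (sym (+-suc k p)) (lower rows (suc k) (s≤s k<m) c x<c)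
  ; top = λ c x<c → ∈-row-≡ (sym (+-suc m p)) (top rows c x<c)
  }

rows-restrict : ∀ {D p x m b z} → Rows D p x (suc m) b z → Rows D p x m b (b m)
rows-restrict rows = record
  { lower = λ k k<m → lower rows k (m≤n⇒m≤1+n k<m)
  ; top = lower rows _ ≤-refl
  }

rows-collapse : ∀ {D p x m b z} → 1 ≤ m + p → Rows D p x (suc m) b z → b m ≡ 0 →
  ∃[ k ] ∃[ E ] (Path k D E × Rows E p x m b z)
rows-collapse {D} {p} {x} {m} {b} {z} m+p≥1 rows bₘ≡0 =
  Shift.steps sh , Shift.result sh , Shift.path sh , record { lower = lower' ; top = top' }
  where
  empty-row : ∀ {c} → x < c → (m + p , c) ∉ D
  empty-row x<c mem = not-right-of x<c (subst (λ e → _ ≤ x + e) bₘ≡0 (to (lower rows m ≤-refl _ x<c) mem))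
  sh : Shift x (x + z) (m + p) D
  sh = shift (x + z) D (m≤m+n x z) m+p≥1
    (λ c (x<c , c≤) → from (top rows c x<c) c≤)
    (λ c mem → case-≤ c mem)
    (λ c (x<c , _) → empty-row x<c)
    where
    case-≤ : ∀ c → (suc m + p , c) ∈ D → c ≤ x + z
    case-≤ c mem with c ≤? x
    ... | yes c≤x = ≤-trans c≤x (m≤m+n x z)
    ... | no c≰x = to (top rows c (≰⇒> c≰x)) mem
  shifted : Shifted x (x + z) (m + p) D (Shift.result sh)
  shifted = Shift.shifted sh
  lower' : ∀ k → k < m → ∀ c → x < c → (k + p , c) ∈ Shift.result sh ⇔ c ≤ x + b k
  lower' k k<m c x<c = mk⇔ ⇒ ⇐
    where
    k+p<m+p : k + p < m + p
    k+p<m+p = +-monoˡ-< p k<m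
    ⇒ : (k + p , c) ∈ Shift.result sh → c ≤ x + b k
    ⇒ mem with to (shifted (k + p) c) mem
    ... | inj₁ (mem' , _) = to (lower rows k (m≤n⇒m≤1+n k<m) c x<c) mem'
    ... | inj₂ (e , _) = ⊥-elim (<-irrefl e k+p<m+p)
    ⇐ : c ≤ x + b k → (k + p , c) ∈ Shift.result sh
    ⇐ c≤ = from (shifted (k + p) c) (inj₁ (from (lower rows k (m≤n⇒m≤1+n k<m) c x<c) c≤ ,
      λ (e , _) → <-irrefl e (m≤n⇒m≤1+n k+p<m+p)))
  top' : ∀ c → x < c → (m + p , c) ∈ Shift.result sh ⇔ c ≤ x + z
  top' c x<c = mk⇔ ⇒ (λ c≤ → from (shifted (m + p) c) (inj₂ (refl , x<c , c≤)))
    where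
    ⇒ : (m + p , c) ∈ Shift.result sh → c ≤ x + z
    ⇒ mem with to (shifted (m + p) c) mem
    ... | inj₁ (mem' , _) = ⊥-elim (empty-row x<c mem')
    ... | inj₂ (_ , _ , c≤) = c≤

dropCorner : (ℕ → ℕ) → ℕ → ℕ
dropCorner b zero = 0
dropCorner b (suc k) = b (suc (suc k))

-- The single cell past column x in row p + 1 drops into row p, after which
-- rows p + 1, p + 2, … form a configuration whose bottom row is empty past x.
rows-drop-corner : ∀ {D p x m b z} → 1 ≤ p → Rows D p x (suc (suc m)) b z → b 0 ≡ 0 → b 1 ≡ 1 →
  ∃[ E ] (Path 1 D E × Rows E (suc p) x (suc m) (dropCorner b) z)
rows-drop-corner {D} {p} {x} {m} {b} {z} p≥1 rows b₀≡0 b₁≡1 =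
  E , corner ◅ ε , record { lower = lower' ; top = top' }
  where
  x<1+x : x < suc x
  x<1+x = n<1+n x
  row₁ : ∀ {c} → x < c → (suc p , c) ∈ D ⇔ c ≤ suc x
  row₁ {c} x<c = subst (λ e → (suc p , c) ∈ D ⇔ c ≤ e) (trans (cong (x +_) b₁≡1) (+-comm x 1))
    (lower rows 1 (s≤s (s≤s z≤n)) c x<c)
  corner : CoverMove (suc p) (suc x) p D
  corner = adjacentMove (from (row₁ x<1+x) ≤-refl) rightmost p≥1
    (λ mem → not-right-of x<1+x (subst (λ e → suc x ≤ x + e) b₀≡0 (to (lower rows 0 (s≤s z≤n) _ x<1+x) mem)))
    where
    rightmost : ∀ c → (suc p , c) ∈ D → c ≤ suc x
    rightmost c mem with c ≤? x
    ... | yes c≤x = m≤n⇒m≤1+n c≤x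
    ... | no c≰x = to (row₁ (≰⇒> c≰x)) mem
  E : Diagram
  E = move (suc p) (suc x) p D
  unmoved : ∀ {r c} → suc p < r → (r , c) ∈ E ⇔ (r , c) ∈ D
  unmoved p+1<r = mk⇔
    (λ mem → case ∈-move⁻ _ mem of λ
      { (inj₁ e) → ⊥-elim (<-irrefl (sym (cong proj₁ e)) (<-trans (n<1+n p) p+1<r))
      ; (inj₂ (mem' , _)) → mem' })
    (λ mem → ∈-move⁺ {D = D} _ (inj₂ (mem , λ e → <-irrefl (sym (cong proj₁ e)) p+1<r)))
  lower' : ∀ k → k < suc m → ∀ c → x < c → (k + suc p , c) ∈ E ⇔ c ≤ x + dropCorner b k
  lower' zero _ c x<c = mk⇔ ⇒ (λ c≤x+0 → ⊥-elim (not-right-of x<c c≤x+0))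
    where
    ⇒ : (suc p , c) ∈ E → c ≤ x + 0
    ⇒ mem with ∈-move⁻ _ mem
    ... | inj₁ e = ⊥-elim (<-irrefl (sym (cong proj₁ e)) (n<1+n p))
    ... | inj₂ (mem' , ≢corner) = ⊥-elim (≢corner (cong (suc p ,_) (≤-antisym (to (row₁ x<c) mem') x<c)))
  lower' (suc k) (s≤s k<m) c x<c = ∈-row-≡ (sym (+-suc (suc k) p))
    (lower rows (suc (suc k)) (s≤s (s≤s k<m)) c x<c ⇔-∘ unmoved (s≤s (s≤s (m≤n+m p k))))
  top' : ∀ c → x < c → (suc m + suc p , c) ∈ E ⇔ c ≤ x + z
  top' c x<c = ∈-row-≡ (sym (+-suc (suc m) p))
    (top rows c x<c ⇔-∘ unmoved (s≤s (s≤s (m≤n+m p m))))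

-- Reduction to three adjacent rows

module _ {D₀ : Diagram} {B : ℕ} (bd₀ : RowBounded B D₀) (R : KohnertRanked D₀) where

  ViolationUnreachable : ℕ → Set
  ViolationUnreachable m = ∀ {j D p x b z} → Path j D₀ D → 1 ≤ p → Rows D p x m b z → b 0 ≡ 0 →
    ∀ q → 0 < q → q < m → Violation (b q) z → ⊥

  -- With the top row at p + h: either row p + 1 is empty past x (forget row
  -- p), or row p + h - 1 is (slide the top row into it), or rows p + 1 and
  -- p + h - 1 already violate purity with row p. Otherwise both are a single
  -- cell past x, and either the top row violates purity with row p + 1 once
  -- that cell has dropped to row p, or the top row is a single cell as well
  -- and can be forgotten.
  violation-unreachable-step : ∀ m → ViolationUnreachable (suc (suc m)) → ViolationUnreachable (suc (suc (suc m)))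
  violation-unreachable-step m IH {b = b} {z} P₀ p≥1 rows b₀≡0 q 0<q q<m+3 violation with b 1 ≟ 0
  violation-unreachable-step m IH P₀ p≥1 rows b₀≡0 (suc zero) _ _ violation | yes b₁≡0 =
    <⇒≱ (violation-left≥1 violation) (≤-reflexive b₁≡0)
  violation-unreachable-step m IH P₀ p≥1 rows b₀≡0 (suc (suc q)) _ (s≤s q<m+2) violation | yes b₁≡0 =
    IH P₀ (s≤s z≤n) (rows-raise rows) b₁≡0 (suc q) (s≤s z≤n) q<m+2 violation
  ... | no b₁≢0 with b (suc (suc m)) ≟ 0
  ...   | yes bₘ₊₂≡0 with rows-collapse (s≤s z≤n) rows bₘ₊₂≡0
  ...     | (_ , _ , P , rows') = IH (P₀ ◅◅ P) p≥1 rows' b₀≡0 q 0<q (≤∧≢⇒< (≤-pred q<m+3) q≢m+2) violation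
    where
    q≢m+2 : q ≢ suc (suc m)
    q≢m+2 refl = <⇒≱ (violation-left≥1 violation) (≤-reflexive bₘ₊₂≡0)
  violation-unreachable-step m IH {b = b} {z} P₀ p≥1 rows b₀≡0 q 0<q q<m+3 violation | no b₁≢0 | no bₘ₊₂≢0
    with violation? (b 1) (b (suc (suc m)))
  ... | yes inner = IH P₀ p≥1 (rows-restrict rows) b₀≡0 1 (s≤s z≤n) (s≤s (s≤s z≤n)) inner
  ... | no no-inner with no-violation (n≢0⇒n>0 b₁≢0) (n≢0⇒n>0 bₘ₊₂≢0) no-inner
  ...   | b₁≡1 , bₘ₊₂≡1 with violation? 1 z
  ...     | yes outer with rows-drop-corner p≥1 rows b₀≡0 b₁≡1
  ...       | (_ , P , rows') =
    IH (P₀ ◅◅ P) (s≤s z≤n) rows' refl (suc m) (s≤s z≤n) ≤-refl (subst (λ V → Violation V z) (sym bₘ₊₂≡1) outer)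
  violation-unreachable-step m IH {b = b} {z} P₀ p≥1 rows b₀≡0 q 0<q q<m+3 violation
    | no b₁≢0 | no bₘ₊₂≢0 | no no-inner | b₁≡1 , bₘ₊₂≡1 | no no-outer =
    IH P₀ p≥1 (rows-restrict rows) b₀≡0 q 0<q (≤∧≢⇒< (≤-pred q<m+3) q≢m+2)
      (subst (Violation (b q)) (trans z≡1 (sym bₘ₊₂≡1)) violation)
    where
    z≡1 : z ≡ 1
    z≡1 = proj₂ (no-violation (s≤s z≤n) (violation-right≥1 violation) no-outer)
    q≢m+2 : q ≢ suc (suc m)
    q≢m+2 refl = no-outer (subst (λ V → Violation V z) bₘ₊₂≡1 violation)

  violation-unreachable : ∀ m → ViolationUnreachable m
  violation-unreachable zero _ _ _ _ _ _ ()
  violation-unreachable (suc zero) _ _ _ _ (suc _) _ (s≤s ())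
  violation-unreachable (suc (suc zero)) P₀ p≥1 rows b₀≡0 (suc zero) _ _ violation =
    violation-unranked bd₀ R P₀ p≥1 (rows-windowed rows b₀≡0) violation
  violation-unreachable (suc (suc zero)) _ _ _ _ (suc (suc _)) _ (s≤s (s≤s ()))
  violation-unreachable (suc (suc (suc m))) = violation-unreachable-step m (violation-unreachable (suc (suc m)))

-- entry xs i is the i-th element of xs, and 0 past its end.
entry : List ℕ → ℕ → ℕ
entry [] _ = 0
entry (h ∷ t) zero = h
entry (h ∷ t) (suc i) = entry t i

entry-lookup : ∀ {n} (a : Vec ℕ n) (j : Fin n) → entry (toList a) (toℕ j) ≡ lookup a j
entry-lookup (_ ∷ᵥ _) fzero = refl
entry-lookup (_ ∷ᵥ a) (fsuc j) = entry-lookup a j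

entry≥1⇒< : ∀ xs i → 1 ≤ entry xs i → i < length xs
entry≥1⇒< (h ∷ t) zero _ = s≤s z≤n
entry≥1⇒< (h ∷ t) (suc i) e≥1 = s≤s (entry≥1⇒< t i e≥1)

∈-keyFrom⁻ : ∀ r₀ xs {r c} → (r , c) ∈ keyFrom r₀ xs → ∃[ i ] (r ≡ i + r₀ × 1 ≤ c × c ≤ entry xs i)
∈-keyFrom⁻ r₀ (h ∷ t) m with ∈-++⁻ (map (λ j → (r₀ , suc j)) (upTo h)) m
... | inj₁ m₁ with ∈-map⁻ (λ j → (r₀ , suc j)) m₁
...   | (j , j∈ , refl) = 0 , refl , s≤s z≤n , ∈-upTo⁻ j∈
∈-keyFrom⁻ r₀ (h ∷ t) m | inj₂ m₂ with ∈-keyFrom⁻ (suc r₀) t m₂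
...   | (i , r≡ , 1≤c , c≤) = suc i , trans r≡ (+-suc i r₀) , 1≤c , c≤

∈-keyFrom⁺ : ∀ r₀ xs i {c} → 1 ≤ c → c ≤ entry xs i → (i + r₀ , c) ∈ keyFrom r₀ xs
∈-keyFrom⁺ r₀ (h ∷ t) zero {suc c} _ c≤h = ∈-++⁺ˡ (∈-map⁺ (λ j → (r₀ , suc j)) (∈-upTo⁺ c≤h))
∈-keyFrom⁺ r₀ (h ∷ t) (suc i) {c} 1≤c c≤ = ∈-++⁺ʳ (map (λ j → (r₀ , suc j)) (upTo h))
  (subst (λ r → (r , c) ∈ keyFrom (suc r₀) t) (+-suc i r₀) (∈-keyFrom⁺ (suc r₀) t i 1≤c c≤))
∈-keyFrom⁺ r₀ [] zero {suc c} _ ()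
∈-keyFrom⁺ r₀ [] (suc i) {suc c} _ ()

keyFrom-rowBounded : ∀ xs → RowBounded (length xs + 1) (keyFrom 1 xs)
keyFrom-rowBounded xs r c m with ∈-keyFrom⁻ 1 xs m
... | (i , refl , 1≤c , c≤) = +-monoˡ-≤ 1 (<⇒≤ (entry≥1⇒< xs i (≤-trans 1≤c c≤)))

keyFrom-row : ∀ xs i x {c} → x < c → (suc i , c) ∈ keyFrom 1 xs ⇔ c ≤ x + (entry xs i ∸ x)
keyFrom-row xs i x {c} x<c = mk⇔ ⇒ ⇐
  where
  ⇒ : (suc i , c) ∈ keyFrom 1 xs → c ≤ x + (entry xs i ∸ x)
  ⇒ m with ∈-keyFrom⁻ 1 xs m
  ... | (i' , r≡ , _ , c≤) rewrite suc-injective (trans r≡ (+-comm i' 1)) = ≤-trans c≤ (m≤n+m∸n _ x)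
  ⇐ : c ≤ x + (entry xs i ∸ x) → (suc i , c) ∈ keyFrom 1 xs
  ⇐ c≤ = subst (λ r → (r , c) ∈ keyFrom 1 xs) (+-comm i 1)
    (∈-keyFrom⁺ 1 xs i (≤-trans (s≤s z≤n) x<c) (c≤x+[e∸x]⇒c≤e c≤))
    where
    c≤x+[e∸x]⇒c≤e : ∀ {e} → c ≤ x + (e ∸ x) → c ≤ e
    c≤x+[e∸x]⇒c≤e {e} c≤ with x ≤? e
    ... | yes x≤e = ≤-trans c≤ (≤-reflexive (m+[n∸m]≡n x≤e))
    ... | no x≰e = ⊥-elim (not-right-of x<c (subst (λ d → c ≤ x + d) (m≤n⇒m∸n≡0 (<⇒≤ (≰⇒> x≰e))) c≤))

keyFrom-rows : ∀ xs i₁ x m → Rows (keyFrom 1 xs) (suc i₁) x m (λ k → entry xs (k + i₁) ∸ x) (entry xs (m + i₁) ∸ x)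
keyFrom-rows xs i₁ x m = record
  { lower = λ k _ _ x<c → shifted k x<c
  ; top = λ _ x<c → shifted m x<c
  }
  where
  shifted : ∀ k {c} → x < c → (k + suc i₁ , c) ∈ keyFrom 1 xs ⇔ c ≤ x + (entry xs (k + i₁) ∸ x)
  shifted k x<c = ∈-row-≡ (sym (+-suc k i₁)) (keyFrom-row xs (k + i₁) x x<c)

-- Pure a unfolds to ∀ j₁ j₂ j₃ → j₁ < j₂ → j₂ < j₃ → ¬ Forbidden (a j₁) (a j₂) (a j₃).
Forbidden : ℕ → ℕ → ℕ → Set
Forbidden a₁ a₂ a₃ = (a₁ < a₂ × a₂ < a₃) ⊎ (a₁ < a₃ × a₃ < a₂) ⊎ (suc a₁ < a₂ × a₂ ≡ a₃)

forbidden? : ∀ a₁ a₂ a₃ → Dec (Forbidden a₁ a₂ a₃)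
forbidden? a₁ a₂ a₃ = (a₁ <? a₂ ×-dec a₂ <? a₃) ⊎-dec (a₁ <? a₃ ×-dec a₃ <? a₂) ⊎-dec (suc a₁ <? a₂ ×-dec a₂ ≟ a₃)

forbidden⇒violation : ∀ {a₁ a₂ a₃} → Forbidden a₁ a₂ a₃ → Violation (a₂ ∸ a₁) (a₃ ∸ a₁)
forbidden⇒violation (inj₁ (a₁<a₂ , a₂<a₃)) = inj₁ (m<n⇒0<n∸m a₁<a₂ , m<n⇒0<n∸m (<-trans a₁<a₂ a₂<a₃) ,
  λ e → <-irrefl (∸-cancelʳ-≡ (<⇒≤ a₁<a₂) (<⇒≤ (<-trans a₁<a₂ a₂<a₃)) e) a₂<a₃)
forbidden⇒violation (inj₂ (inj₁ (a₁<a₃ , a₃<a₂))) = inj₁ (m<n⇒0<n∸m (<-trans a₁<a₃ a₃<a₂) , m<n⇒0<n∸m a₁<a₃ ,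
  λ e → <-irrefl (sym (∸-cancelʳ-≡ (<⇒≤ (<-trans a₁<a₃ a₃<a₂)) (<⇒≤ a₁<a₃) e)) a₃<a₂)
forbidden⇒violation {a₁} (inj₂ (inj₂ (2+a₁≤a₂ , refl))) =
  inj₂ (≤-trans (≤-reflexive (sym (m+n∸n≡m 2 a₁))) (∸-monoˡ-≤ a₁ 2+a₁≤a₂) , refl)

ForbiddenTriple : ∀ {n} → Vec ℕ n → Set
ForbiddenTriple a = ∃[ j₁ ] ∃[ j₂ ] ∃[ j₃ ]
  (j₁ Fin.< j₂ × j₂ Fin.< j₃ × Forbidden (lookup a j₁) (lookup a j₂) (lookup a j₃))

private
  triple? : ∀ {n} (a : Vec ℕ n) j₁ j₂ j₃ →
    Dec (j₁ Fin.< j₂ → j₂ Fin.< j₃ → ¬ Forbidden (lookup a j₁) (lookup a j₂) (lookup a j₃))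
  triple? a j₁ j₂ j₃ = j₁ Fin.<? j₂ →-dec (j₂ Fin.<? j₃ →-dec ¬? (forbidden? _ _ _))

impure-triple : ∀ {n} (a : Vec ℕ n) → ¬ Pure a → ForbiddenTriple a
impure-triple {n} a impure
  with ¬∀⟶∃¬ n _ (λ j₁ → all? λ j₂ → all? (triple? a j₁ j₂)) impure
... | j₁ , ¬∀₁ with ¬∀⟶∃¬ n _ (λ j₂ → all? (triple? a j₁ j₂)) ¬∀₁
... | j₂ , ¬∀₂ with ¬∀⟶∃¬ n _ (triple? a j₁ j₂) ¬∀₂
... | j₃ , ¬triple with j₁ Fin.<? j₂ | j₂ Fin.<? j₃ | forbidden? (lookup a j₁) (lookup a j₂) (lookup a j₃)
... | yes j₁<j₂ | yes j₂<j₃ | yes f = j₁ , j₂ , j₃ , j₁<j₂ , j₂<j₃ , f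
... | no j₁≮j₂ | _ | _ = ⊥-elim (¬triple (λ j₁<j₂ → ⊥-elim (j₁≮j₂ j₁<j₂)))
... | yes _ | no j₂≮j₃ | _ = ⊥-elim (¬triple (λ _ j₂<j₃ → ⊥-elim (j₂≮j₃ j₂<j₃)))
... | yes _ | yes _ | no ¬f = ⊥-elim (¬triple (λ _ _ → ¬f))

keyDiagram-unranked : ∀ {n} (a : Vec ℕ n) → ForbiddenTriple a → ¬ KohnertRanked (keyDiagram a)
keyDiagram-unranked a (j₁ , j₂ , j₃ , j₁<j₂ , j₂<j₃ , forbidden) ranked =
  violation-unreachable (keyFrom-rowBounded xs) ranked (i₃ ∸ i₁) ε (s≤s z≤n) (keyFrom-rows xs i₁ x (i₃ ∸ i₁))
    first-row-empty (i₂ ∸ i₁) (m<n⇒0<n∸m j₁<j₂) (∸-monoˡ-< j₂<j₃ (<⇒≤ j₁<j₂))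
    (subst₂ Violation (sym (row-length j₁<j₂)) (sym (row-length (<-trans j₁<j₂ j₂<j₃)))
      (forbidden⇒violation forbidden))
  where
  xs : List ℕ
  xs = toList a
  i₁ i₂ i₃ x : ℕ
  i₁ = toℕ j₁
  i₂ = toℕ j₂
  i₃ = toℕ j₃
  x = lookup a j₁
  first-row-empty : entry xs i₁ ∸ x ≡ 0
  first-row-empty = trans (cong (_∸ x) (entry-lookup a j₁)) (n∸n≡0 x)
  row-length : ∀ {j} → i₁ < toℕ j → entry xs ((toℕ j ∸ i₁) + i₁) ∸ x ≡ lookup a j ∸ x
  row-length i₁<j = cong (_∸ x) (trans (cong (entry xs) (m∸n+n≡m (<⇒≤ i₁<j))) (entry-lookup a _))

theorem6p13 : (n : ℕ) (a : Vec ℕ n) → ¬ Pure a → ¬ KohnertRanked (keyDiagram a)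
theorem6p13 n a impure = keyDiagram-unranked a (impure-triple a impure)
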